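{- Let $v$ be a vertex of $K_{m+1}$ and let $\mathcal{E}=\{E_1,\dots,E_m\}$ be a family of subgraphs of $K_{m+1}$, each of which is either a star centered at $v$ or a cycle. Suppose that $\mathcal{E}$ has no rainbow cycle, and every star in $\mathcal{E}$ is edge-disjoint from all other members of $\mathcal{E}$. If $E_1$ is a star, then there exist $\ell$ cycles in $\mathcal{E}$ avoiding $v$, for some $0<\ell<m$, whose union together with $E_1$ contains at most $\ell+2$ vertices.
   Context: Subgraphs are regarded as edge sets. A star is a set of at least $2$ edges sharing one common vertex, its center. A family means a multiset. Given a family $\mathcal{E}$ of edge sets, an $\mathcal{E}$-rainbow set is a set $R\subseteq\bigcup\mathcal{E}$ with an injection $\sigma:R\to\mathcal{E}$ such that $e\in\sigma(e)$ for all $e\in R$; a rainbow cycle is a rainbow set forming a cycle. -}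

module Defs where

open import Data.Nat using (ℕ; zero; suc; _∸_; _≤_; _<_)
open import Data.Fin using (Fin; toℕ) renaming (_<_ to _<ᶠ_)
open import Data.Bool using (Bool; true; false)
open import Data.Product using (Σ; ∃; ∃-syntax; _×_; _,_; proj₁; proj₂)
open import Data.Sum using (_⊎_)
open import Relation.Binary.PropositionalEquality using (_≡_; _≢_)
open import Relation.Nullary using (¬_)
open import Function using (_⇔_)

Edge : ℕ → Set
Edge n = Σ (Fin n) λ i → Σ (Fin n) λ j → i <ᶠ j

EdgeSet : ℕ → Set
EdgeSet n = Edge n → Bool

_∈ₑ_ : ∀ {n} → Edge n → EdgeSet n → Set
e ∈ₑ S = S e ≡ true

Incident : ∀ {n} → Fin n → Edge n → Set
Incident x (i , j , _) = (x ≡ i) ⊎ (x ≡ j)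

Joins : ∀ {n} → Edge n → Fin n → Fin n → Set
Joins (i , j , _) x y = ((i ≡ x) × (j ≡ y)) ⊎ ((i ≡ y) × (j ≡ x))

IsStarAt : ∀ {n} → Fin n → EdgeSet n → Set
IsStarAt v S =
  (∀ e → e ∈ₑ S → Incident v e) ×
  (∃[ e₁ ] ∃[ e₂ ] (e₁ ≢ e₂ × e₁ ∈ₑ S × e₂ ∈ₑ S))

CycSucc : ∀ {k} → Fin k → Fin k → Set
CycSucc {k} i j = (toℕ j ≡ suc (toℕ i)) ⊎ ((toℕ i ≡ k ∸ 1) × (toℕ j ≡ 0))

IsCycle : ∀ {n} → EdgeSet n → Set
IsCycle {n} C =
  ∃[ k ] Σ (Fin k → Fin n) λ f →
    (3 ≤ k) ×
    (∀ i j → f i ≡ f j → i ≡ j) ×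
    (∀ e → e ∈ₑ C ⇔ (∃[ i ] ∃[ j ] (CycSucc i j × Joins e (f i) (f j))))

IsRainbow : ∀ {n m} → (Fin m → EdgeSet n) → EdgeSet n → Set
IsRainbow {n} {m} ℰ R =
  Σ (Σ (Edge n) (λ e → e ∈ₑ R) → Fin m) λ σ →
    (∀ x y → σ x ≡ σ y → proj₁ x ≡ proj₁ y) ×
    (∀ x → proj₁ x ∈ₑ ℰ (σ x))

HasRainbowCycle : ∀ {n m} → (Fin m → EdgeSet n) → Set
HasRainbowCycle {n} ℰ = ∃[ R ] (IsRainbow ℰ R × IsCycle R)

Covers : ∀ {n} → (Edge n → Set) → Fin n → Set
Covers U x = ∃[ e ] (U e × Incident x e)

AtMostVertices : ∀ {n} → ℕ → (Edge n → Set) → Set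
AtMostVertices {n} k U =
  Σ (Fin n → Fin k) λ g →
    ∀ x y → Covers U x → Covers U y → g x ≡ g y → x ≡ y

module Submission where

-- Since there is no rainbow cycle, no t members of the family live on at most t vertices;
-- growing a tree greedily therefore yields a rainbow spanning tree of K_{m+1} rooted at v
-- that uses every member once. Let a be the vertex whose tree edge has the colour of the
-- star E₁, so that the parent of a is v. Call a set A of descendants of a, closed upwards
-- up to a, a pocket if every vertex outside A is reached from v by a rainbow path avoiding
-- A and the tree colours of A; the subtree of a is one. If the member coloured by some
-- w ∈ A ∖ {a} leaves A along an edge x y with x ∈ A, then w is an ancestor of x (otherwise
-- the tree path from x to v, the path from v to y and the edge y x form a rainbow cycle),
-- and cutting the subtree of w out of A leaves a pocket. Once no member coloured by
-- A ∖ {a} leaves A, these ℓ members are cycles inside A, every edge of E₁ ends in A, and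
-- E₁ together with the ℓ cycles spans at most the ℓ + 2 vertices of A ∪ {v}.

open import Defs
open import Data.Nat using (ℕ; zero; suc; _+_; _∸_; _≤_; _<_; z≤n; s≤s)
import Data.Nat.Properties as ℕP
open import Data.Fin using (Fin; zero; suc; toℕ; fromℕ; fromℕ<) renaming (_<_ to _<ᶠ_)
import Data.Fin.Properties as FP
open import Data.Fin.Properties using (toℕ-injective; any?)
open import Data.Bool using (true; false)
open import Data.Product using (Σ; ∃; ∃-syntax; _×_; _,_; proj₁; proj₂)
open import Data.Sum using (_⊎_; inj₁; inj₂)
open import Data.Empty using (⊥; ⊥-elim)
open import Data.Unit using (⊤; tt)
open import Data.List using (List; []; _∷_; _++_; length; map; reverse; filter; lookup; allFin)
import Data.List.Properties as LP
open import Data.List.Relation.Unary.Unique.Propositional using (Unique; []; _∷_)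
import Data.List.Relation.Unary.Unique.Propositional.Properties as UniqueP
open import Data.List.Relation.Unary.All as All using (All; []; _∷_)
open import Data.List.Relation.Unary.All.Properties.Core using (¬All⇒Any¬)
open import Data.List.Relation.Unary.Any as Any using (Any; here; there)
import Data.List.Relation.Unary.Any.Properties as AnyP
open import Data.List.Membership.Propositional using (_∈_; _∉_; find; lose)
import Data.List.Membership.Propositional.Properties as ∈P
open import Data.List.Relation.Binary.Subset.Propositional using (_⊆_)
open import Data.List.Relation.Binary.Disjoint.Propositional using (Disjoint)
open import Relation.Binary.PropositionalEquality
open import Relation.Binary using (tri<; tri≈; tri>; DecidableEquality)
open import Relation.Nullary using (¬_; Dec; yes; no; ¬?; does)
open import Relation.Nullary.Decidable using (dec-true; _×-dec_; _⊎-dec_)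
open import Relation.Unary using (Decidable; ∁)
open import Function using (_⇔_; mk⇔; id)
open import Function.Bundles using (Equivalence)

private
  variable
    X : Set

true⇒witness : ∀ {P : Set} (P? : Dec P) → does P? ≡ true → P
true⇒witness (yes p) _ = p

Unique⇒length≤ : {xs ys : List X} → Unique xs → xs ⊆ ys → length xs ≤ length ys
Unique⇒length≤ {xs = []} _ _ = z≤n
Unique⇒length≤ {xs = x ∷ xs} {ys} (x∉xs ∷ xs!) xs⊆ys with ∈P.∈-∃++ (xs⊆ys (here refl))
... | ys₁ , ys₂ , refl = subst (suc (length xs) ≤_) (sym length-drop-x) (s≤s (Unique⇒length≤ xs! xs⊆ys₁ys₂))
  where
  xs⊆ys₁ys₂ : xs ⊆ ys₁ ++ ys₂
  xs⊆ys₁ys₂ z∈xs with ∈P.∈-++⁻ ys₁ (xs⊆ys (there z∈xs))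
  ... | inj₁ p = ∈P.∈-++⁺ˡ p
  ... | inj₂ (here refl) = ⊥-elim (All.lookup x∉xs z∈xs refl)
  ... | inj₂ (there p) = ∈P.∈-++⁺ʳ ys₁ p
  length-drop-x : length (ys₁ ++ x ∷ ys₂) ≡ suc (length (ys₁ ++ ys₂))
  length-drop-x = begin
    length (ys₁ ++ x ∷ ys₂)           ≡⟨ LP.length-++ ys₁ ⟩
    length ys₁ + suc (length ys₂)     ≡⟨ ℕP.+-suc (length ys₁) (length ys₂) ⟩
    suc (length ys₁ + length ys₂)     ≡⟨ cong suc (LP.length-++ ys₁) ⟨
    suc (length (ys₁ ++ ys₂))         ∎
    where open ≡-Reasoning

Unique⇒length< : {xs ys : List X} {y : X} → Unique xs → xs ⊆ ys → y ∈ ys → y ∉ xs → length xs < length ys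
Unique⇒length< {xs = xs} xs! xs⊆ys y∈ys y∉xs =
  Unique⇒length≤ (All.tabulate (λ z∈xs y≡z → y∉xs (subst (_∈ xs) (sym y≡z) z∈xs)) ∷ xs!)
    λ { (here refl) → y∈ys ; (there p) → xs⊆ys p }

Unique⇒2≤length : {xs : List X} {x y : X} → x ≢ y → x ∈ xs → y ∈ xs → Unique xs → 2 ≤ length xs
Unique⇒2≤length x≢y x∈ y∈ xs! =
  Unique⇒length≤ ((x≢y ∷ []) ∷ [] ∷ []) λ { (here refl) → x∈ ; (there (here refl)) → y∈ }

Unique⇒3≤length : {xs : List X} {x y z : X} → x ≢ y → x ≢ z → y ≢ z →
                  x ∈ xs → y ∈ xs → z ∈ xs → Unique xs → 3 ≤ length xs
Unique⇒3≤length x≢y x≢z y≢z x∈ y∈ z∈ xs! =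
  Unique⇒length≤ ((x≢y ∷ x≢z ∷ []) ∷ (y≢z ∷ []) ∷ [] ∷ [])
    λ { (here refl) → x∈ ; (there (here refl)) → y∈ ; (there (there (here refl))) → z∈ }

length-filter+length-filter-∁ : {P : X → Set} (P? : Decidable P) (xs : List X) →
                                 length (filter P? xs) + length (filter (λ x → ¬? (P? x)) xs) ≡ length xs
length-filter+length-filter-∁ P? [] = refl
length-filter+length-filter-∁ P? (x ∷ xs) with P? x
... | yes _ = cong suc (length-filter+length-filter-∁ P? xs)
... | no _ = trans (ℕP.+-suc (length (filter P? xs)) _) (cong suc (length-filter+length-filter-∁ P? xs))

Unique-map-injectiveOn : ∀ {B : Set} {P : X → Set} (f : X → B) {xs : List X} → Unique xs → All P xs →
                         (∀ {x y} → P x → P y → f x ≡ f y → x ≡ y) → Unique (map f xs)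
Unique-map-injectiveOn f [] [] inj = []
Unique-map-injectiveOn f {x ∷ xs} (x∉xs ∷ xs!) (px ∷ pxs) inj =
  All.tabulate fx∉ ∷ Unique-map-injectiveOn f xs! pxs inj
  where
  fx∉ : ∀ {z} → z ∈ map f xs → f x ≢ z
  fx∉ z∈ fx≡z with ∈P.∈-map⁻ f z∈
  ... | w , w∈ , refl = All.lookup x∉xs w∈ (inj px (All.lookup pxs w∈) fx≡z)

Unique-++⁻ : (xs : List X) {ys : List X} → Unique (xs ++ ys) → Unique xs × Unique ys × Disjoint xs ys
Unique-++⁻ [] ys! = [] , ys! , λ ()
Unique-++⁻ (x ∷ xs) (x∉ ∷ xsys!) with Unique-++⁻ xs xsys!
... | xs! , ys! , xs#ys =
  All.tabulate (λ z∈ → All.lookup x∉ (∈P.∈-++⁺ˡ z∈)) ∷ xs! , ys! ,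
  λ { (here refl , q) → All.lookup x∉ (∈P.∈-++⁺ʳ xs q) refl ; (there p , q) → xs#ys (p , q) }

Unique-reverse : {xs : List X} → Unique xs → Unique (reverse xs)
Unique-reverse [] = []
Unique-reverse {xs = x ∷ xs} (x∉xs ∷ xs!) = subst Unique (sym (LP.unfold-reverse x xs))
  (UniqueP.++⁺ (Unique-reverse xs!) ([] ∷ [])
    λ { (p , here refl) → All.lookup x∉xs (AnyP.reverse⁻ p) refl })

module _ {A : Set} (_≟_ : DecidableEquality A) where
  open import Data.List.Membership.DecPropositional _≟_ using (_∈?_)

  Unique⇒∃∉ : {xs ys : List A} → Unique xs → length ys < length xs → ∃ λ x → x ∈ xs × x ∉ ys
  Unique⇒∃∉ {xs} {ys} xs! ys<xs with All.all? (_∈? ys) xs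
  ... | yes xs⊆ys = ⊥-elim (ℕP.<⇒≱ ys<xs (Unique⇒length≤ xs! (All.lookup xs⊆ys)))
  ... | no xs⊈ys = find (¬All⇒Any¬ (_∈? ys) xs xs⊈ys)

  position : A → (xs : List A) → A → Fin (suc (length xs))
  position x₀ xs z with z ∈? (x₀ ∷ xs)
  ... | yes z∈ = Any.index z∈
  ... | no _ = zero

  position-injective : ∀ x₀ xs {y z} → y ∈ x₀ ∷ xs → z ∈ x₀ ∷ xs → position x₀ xs y ≡ position x₀ xs z → y ≡ z
  position-injective x₀ xs {y} {z} y∈ z∈ eq with y ∈? (x₀ ∷ xs) | z ∈? (x₀ ∷ xs)
  ... | yes p | yes q = trans (AnyP.lookup-index p) (trans (cong (lookup (x₀ ∷ xs)) eq) (sym (AnyP.lookup-index q)))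
  ... | no y∉ | _ = ⊥-elim (y∉ y∈)
  ... | yes _ | no z∉ = ⊥-elim (z∉ z∈)

Unique-lookup-injective : {xs : List X} → Unique xs → ∀ i j → lookup xs i ≡ lookup xs j → i ≡ j
Unique-lookup-injective {xs = x ∷ xs} _ zero zero _ = refl
Unique-lookup-injective {xs = x ∷ xs} (x∉ ∷ _) zero (suc j) eq = ⊥-elim (All.lookup x∉ (∈P.∈-lookup j) eq)
Unique-lookup-injective {xs = x ∷ xs} (x∉ ∷ _) (suc i) zero eq = ⊥-elim (All.lookup x∉ (∈P.∈-lookup i) (sym eq))
Unique-lookup-injective {xs = x ∷ xs} (_ ∷ xs!) (suc i) (suc j) eq = cong suc (Unique-lookup-injective xs! i j eq)

split-at-first : {P : X → Set} (P? : Decidable P) (xs : List X) → Any P xs →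
                 ∃ λ pre → ∃ λ u → ∃ λ post → xs ≡ pre ++ u ∷ post × P u × All (∁ P) pre
split-at-first P? (x ∷ xs) any with P? x
... | yes px = [] , x , xs , refl , px , []
split-at-first P? (x ∷ xs) (here px) | no ¬px = ⊥-elim (¬px px)
split-at-first P? (x ∷ xs) (there any) | no ¬px with split-at-first P? xs any
... | pre , u , post , refl , pu , ¬ps = x ∷ pre , u , post , refl , pu , ¬px ∷ ¬ps

-- ℕ-indexed lookup with a default value, to avoid casting between Fin (length xs) and Fin k.
nth : List X → X → ℕ → X
nth [] d _ = d
nth (x ∷ xs) d zero = x
nth (x ∷ xs) d (suc t) = nth xs d t

nth-++ˡ : (xs ys : List X) (d : X) (t : ℕ) → t < length xs → nth (xs ++ ys) d t ≡ nth xs d t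
nth-++ˡ (x ∷ xs) ys d zero _ = refl
nth-++ˡ (x ∷ xs) ys d (suc t) (s≤s t<) = nth-++ˡ xs ys d t t<

nth-++ʳ : (xs ys : List X) (d : X) → nth (xs ++ ys) d (length xs) ≡ nth ys d 0
nth-++ʳ [] ys d = refl
nth-++ʳ (x ∷ xs) ys d = nth-++ʳ xs ys d

nth-∈ : (xs : List X) (d : X) (t : ℕ) → t < length xs → nth xs d t ∈ xs
nth-∈ (x ∷ xs) d zero _ = here refl
nth-∈ (x ∷ xs) d (suc t) (s≤s t<) = there (nth-∈ xs d t t<)

nth-injective : (xs : List X) (d : X) → Unique xs → ∀ s t → s < length xs → t < length xs →
                nth xs d s ≡ nth xs d t → s ≡ t
nth-injective (x ∷ xs) d _ zero zero _ _ _ = refl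
nth-injective (x ∷ xs) d (x∉ ∷ _) zero (suc t) _ (s≤s t<) eq = ⊥-elim (All.lookup x∉ (nth-∈ xs d t t<) eq)
nth-injective (x ∷ xs) d (x∉ ∷ _) (suc s) zero (s≤s s<) _ eq = ⊥-elim (All.lookup x∉ (nth-∈ xs d s s<) (sym eq))
nth-injective (x ∷ xs) d (_ ∷ xs!) (suc s) (suc t) (s≤s s<) (s≤s t<) eq = cong suc (nth-injective xs d xs! s t s< t< eq)

module Edges {n : ℕ} where

  edge-irrelevant : ∀ {i j : Fin n} (p q : i <ᶠ j) → _≡_ {A = Edge n} (i , j , p) (i , j , q)
  edge-irrelevant p q rewrite ℕP.<-irrelevant p q = refl

  edge-between : (x y : Fin n) → x ≢ y → Edge n
  edge-between x y x≢y with FP.<-cmp x y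
  ... | tri< x<y _ _ = x , y , x<y
  ... | tri≈ _ x≡y _ = ⊥-elim (x≢y x≡y)
  ... | tri> _ _ y<x = y , x , y<x

  edge-between-joins : ∀ x y (x≢y : x ≢ y) → Joins (edge-between x y x≢y) x y
  edge-between-joins x y x≢y with FP.<-cmp x y
  ... | tri< _ _ _ = inj₁ (refl , refl)
  ... | tri≈ _ x≡y _ = ⊥-elim (x≢y x≡y)
  ... | tri> _ _ _ = inj₂ (refl , refl)

  Joins-sym : ∀ {e : Edge n} {x y} → Joins e x y → Joins e y x
  Joins-sym {i , j , p} (inj₁ eqs) = inj₂ eqs
  Joins-sym {i , j , p} (inj₂ eqs) = inj₁ eqs

  Joins-unique : ∀ {e e′ : Edge n} {x y} → Joins e x y → Joins e′ x y → e ≡ e′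
  Joins-unique {i , j , p} {_ , _ , p′} (inj₁ (refl , refl)) (inj₁ (refl , refl)) = edge-irrelevant p p′
  Joins-unique {i , j , p} {_ , _ , p′} (inj₁ (refl , refl)) (inj₂ (refl , refl)) = ⊥-elim (ℕP.<-asym p p′)
  Joins-unique {i , j , p} {_ , _ , p′} (inj₂ (refl , refl)) (inj₁ (refl , refl)) = ⊥-elim (ℕP.<-asym p p′)
  Joins-unique {i , j , p} {_ , _ , p′} (inj₂ (refl , refl)) (inj₂ (refl , refl)) = edge-irrelevant p p′

  Joins-ends : ∀ {e : Edge n} {x y x′ y′} → Joins e x y → Joins e x′ y′ →
               (x ≡ x′ × y ≡ y′) ⊎ (x ≡ y′ × y ≡ x′)
  Joins-ends {i , j , p} (inj₁ (refl , refl)) (inj₁ (refl , refl)) = inj₁ (refl , refl)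
  Joins-ends {i , j , p} (inj₁ (refl , refl)) (inj₂ (refl , refl)) = inj₂ (refl , refl)
  Joins-ends {i , j , p} (inj₂ (refl , refl)) (inj₁ (refl , refl)) = inj₂ (refl , refl)
  Joins-ends {i , j , p} (inj₂ (refl , refl)) (inj₂ (refl , refl)) = inj₁ (refl , refl)

  Joins⇒≢ : ∀ {e : Edge n} {x y} → Joins e x y → x ≢ y
  Joins⇒≢ {i , j , p} (inj₁ (refl , refl)) refl = ℕP.<-irrefl refl p
  Joins⇒≢ {i , j , p} (inj₂ (refl , refl)) refl = ℕP.<-irrefl refl p

  Joins? : ∀ (e : Edge n) x y → Dec (Joins e x y)
  Joins? (i , j , p) x y = ((i FP.≟ x) ×-dec (j FP.≟ y)) ⊎-dec ((i FP.≟ y) ×-dec (j FP.≟ x))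

  Incident⇒Joins : ∀ {e : Edge n} {x} → Incident x e → ∃[ y ] Joins e x y
  Incident⇒Joins {i , j , p} (inj₁ refl) = j , inj₁ (refl , refl)
  Incident⇒Joins {i , j , p} (inj₂ refl) = i , inj₂ (refl , refl)

  Joins-own-ends : (e : Edge n) → Joins e (proj₁ e) (proj₁ (proj₂ e))
  Joins-own-ends (i , j , p) = inj₁ (refl , refl)

  covered-in⇒AtMostVertices : ∀ {U : Edge n → Set} x₀ xs → (∀ x → Covers U x → x ∈ x₀ ∷ xs) →
                              AtMostVertices (suc (length xs)) U
  covered-in⇒AtMostVertices x₀ xs covered =
    position FP._≟_ x₀ xs , λ x y cx cy → position-injective FP._≟_ x₀ xs (covered x cx) (covered y cy)

  any-edge? : ∀ {P : Edge n → Set} → (∀ e → Dec (P e)) → Dec (∃ P)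
  any-edge? {P} P? with any? (λ i → any? (λ j → ordered? i j))
    where
    ordered? : ∀ i j → Dec (Σ (i <ᶠ j) λ i<j → P (i , j , i<j))
    ordered? i j with i FP.<? j
    ... | no i≮j = no (λ (i<j , _) → i≮j i<j)
    ... | yes i<j with P? (i , j , i<j)
    ...   | yes pe = yes (i<j , pe)
    ...   | no ¬pe = no (λ (i<j′ , pe) → ¬pe (subst P (edge-irrelevant i<j′ i<j) pe))
  ... | yes (i , j , i<j , pe) = yes ((i , j , i<j) , pe)
  ... | no ¬pe = no (λ { ((i , j , i<j) , pe) → ¬pe (i , j , i<j , pe) })

CycSucc-functional : ∀ {K} {i j j′ : Fin K} → CycSucc i j → CycSucc i j′ → j ≡ j′
CycSucc-functional (inj₁ a) (inj₁ b) = toℕ-injective (trans a (sym b))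
CycSucc-functional {suc K} {j = j} (inj₁ a) (inj₂ (b , _)) = ⊥-elim (ℕP.<-irrefl (trans a (cong suc b)) (FP.toℕ<n j))
CycSucc-functional {suc K} {j′ = j′} (inj₂ (b , _)) (inj₁ a) = ⊥-elim (ℕP.<-irrefl (trans a (cong suc b)) (FP.toℕ<n j′))
CycSucc-functional (inj₂ (_ , c)) (inj₂ (_ , c′)) = toℕ-injective (trans c (sym c′))

CycSucc? : ∀ {K} (i j : Fin K) → Dec (CycSucc i j)
CycSucc? {K} i j = (toℕ j ℕP.≟ suc (toℕ i)) ⊎-dec ((toℕ i ℕP.≟ K ∸ 1) ×-dec (toℕ j ℕP.≟ 0))

CycSucc⇒≢ : ∀ {K} → 3 ≤ K → ∀ {a b : Fin K} → CycSucc a b → a ≢ b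
CycSucc⇒≢ _ (inj₁ b≡1+a) refl = ℕP.1+n≢n (sym b≡1+a)
CycSucc⇒≢ {suc (suc (suc K))} _ (inj₂ (a≡last , b≡0)) refl with trans (sym a≡last) b≡0
... | ()
CycSucc⇒≢ {1} (s≤s ()) (inj₂ _) refl
CycSucc⇒≢ {2} (s≤s (s≤s ())) (inj₂ _) refl

CycSucc-forward : ∀ {K} (Q : Fin K → Set) → (∀ i j → CycSucc i j → Q i → Q j) →
                  ∀ a → Q a → ∀ d (b : Fin K) → toℕ b ≡ toℕ a + d → Q b
CycSucc-forward Q step a qa zero b eq = subst Q (toℕ-injective (sym (trans eq (ℕP.+-identityʳ _)))) qa
CycSucc-forward {K} Q step a qa (suc d) b eq =
  step b′ b (inj₁ (trans eq (trans (ℕP.+-suc (toℕ a) d) (cong suc (sym (FP.toℕ-fromℕ< a+d<K))))))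
    (CycSucc-forward Q step a qa d b′ (FP.toℕ-fromℕ< a+d<K))
  where
  a+d<K : toℕ a + d < K
  a+d<K = ℕP.<-trans (subst (toℕ a + d <_) (sym (trans eq (ℕP.+-suc (toℕ a) d))) (ℕP.n<1+n _)) (FP.toℕ<n b)
  b′ : Fin K
  b′ = fromℕ< a+d<K

CycSucc-everywhere : ∀ {K} (Q : Fin K → Set) → (∀ i j → CycSucc i j → Q i → Q j) → ∀ i → Q i → ∀ t → Q t
CycSucc-everywhere {suc K} Q step i qi t = CycSucc-forward Q step zero q-first (toℕ t) t refl
  where
  q-last : Q (fromℕ K)
  q-last = CycSucc-forward Q step i qi (K ∸ toℕ i) (fromℕ K)
             (trans (FP.toℕ-fromℕ K) (sym (ℕP.m+[n∸m]≡n (ℕP.≤-pred (FP.toℕ<n i)))))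
  q-first : Q zero
  q-first = step (fromℕ K) zero (inj₂ (FP.toℕ-fromℕ K , refl)) q-last

-- Walks coloured by members of a family

module Walks {n k : ℕ} (E : Fin k → EdgeSet n) where
  open Edges {n}

  Links : Fin k → Fin n → Fin n → Set
  Links c x y = ∀ e → Joins e x y → e ∈ₑ E c

  Links-sym : ∀ {c x y} → Links c x y → Links c y x
  Links-sym xy e j = xy e (Joins-sym {e} j)

  Links-via : ∀ {c e x y} → e ∈ₑ E c → Joins e x y → Links c x y
  Links-via {c} {e} e∈ j e′ j′ = subst (λ d → d ∈ₑ E c) (Joins-unique {e} {e′} j j′) e∈

  data Walk : List (Fin n) → List (Fin k) → Set where
    end : ∀ x → Walk (x ∷ []) []
    step : ∀ {x y xs c cs} → Links c x y → Walk (y ∷ xs) cs → Walk (x ∷ y ∷ xs) (c ∷ cs)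

  Walk-length : ∀ {xs cs} → Walk xs cs → length xs ≡ suc (length cs)
  Walk-length (end x) = refl
  Walk-length (step _ w) = cong suc (Walk-length w)

  Walk-nth : ∀ {xs cs} → Walk xs cs → ∀ d d′ t → suc t < length xs →
             Links (nth cs d′ t) (nth xs d t) (nth xs d (suc t))
  Walk-nth (step xy w) d d′ zero _ = xy
  Walk-nth (step _ w) d d′ (suc t) (s≤s t<) = Walk-nth w d d′ t t<
  Walk-nth (end x) d d′ t (s≤s ())

  Walk-++ : ∀ xs {y ys cs ds} → Walk (xs ++ y ∷ []) cs → Walk (y ∷ ys) ds → Walk (xs ++ y ∷ ys) (cs ++ ds)
  Walk-++ [] (end _) w = w
  Walk-++ (x ∷ []) (step xy (end _)) w = step xy w
  Walk-++ (x ∷ x′ ∷ xs) (step xy w₁) w₂ = step xy (Walk-++ (x′ ∷ xs) w₁ w₂)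

  Walk-reverse : ∀ {xs cs} → Walk xs cs → Walk (reverse xs) (reverse cs)
  Walk-reverse (end x) = end x
  Walk-reverse (step {x} {y} {xs} {c} {cs} xy w) =
    subst₂ Walk
      (trans (sym (LP.++-assoc (reverse xs) (y ∷ []) (x ∷ [])))
             (trans (cong (_++ x ∷ []) (sym (LP.unfold-reverse y xs))) (sym (LP.unfold-reverse x (y ∷ xs)))))
      (sym (LP.unfold-reverse c cs))
      (Walk-++ (reverse xs) (subst₂ Walk (LP.unfold-reverse y xs) refl (Walk-reverse w)) (step (Links-sym xy) (end x)))

  -- The cycle traversed by a closed walk x, xs, x is read off by nth; the member
  -- assigned to its edge (f i, f (i + 1)) is the i-th colour of the walk.
  closed-walk⇒rainbow-cycle : ∀ x xs cs → Unique (x ∷ xs) → 2 ≤ length xs → Unique cs →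
                              Walk (x ∷ xs ++ x ∷ []) cs → HasRainbowCycle E
  closed-walk⇒rainbow-cycle x [] [] _ () _ _
  closed-walk⇒rainbow-cycle x (y ∷ ys) [] _ _ _ ()
  closed-walk⇒rainbow-cycle x xs (c₀ ∷ cs₀) x∷xs! 2≤ cs! w =
    R , (σ , σ-injective , σ-member) ,
    (K , f , s≤s 2≤ , f-injective , λ e → mk⇔ (true⇒witness (cycle-edge? e)) (dec-true (cycle-edge? e)))
    where
    cs : List (Fin k)
    cs = c₀ ∷ cs₀
    K : ℕ
    K = suc (length xs)
    closed : List (Fin n)
    closed = x ∷ xs ++ x ∷ []
    f : Fin K → Fin n
    f i = nth (x ∷ xs) x (toℕ i)
    length-closed : length closed ≡ suc K
    length-closed = cong suc (trans (LP.length-++ xs) (ℕP.+-comm (length xs) 1))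
    length-cs : length cs ≡ K
    length-cs = ℕP.suc-injective (trans (sym (Walk-length w)) length-closed)
    cycle-edge? : ∀ e → Dec (∃[ i ] ∃[ j ] (CycSucc i j × Joins e (f i) (f j)))
    cycle-edge? e = any? (λ i → any? (λ j → CycSucc? i j ×-dec Joins? e (f i) (f j)))
    R : EdgeSet n
    R e = does (cycle-edge? e)
    f-injective : ∀ i j → f i ≡ f j → i ≡ j
    f-injective i j eq = toℕ-injective (nth-injective (x ∷ xs) x x∷xs! (toℕ i) (toℕ j) (FP.toℕ<n i) (FP.toℕ<n j) eq)
    toℕ<length-cs : ∀ (i : Fin K) → toℕ i < length cs
    toℕ<length-cs i = subst (toℕ i <_) (sym length-cs) (FP.toℕ<n i)
    σ : Σ (Edge n) (λ e → e ∈ₑ R) → Fin k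
    σ (e , e∈R) = nth cs c₀ (toℕ (proj₁ (true⇒witness (cycle-edge? e) e∈R)))
    σ-injective : ∀ a b → σ a ≡ σ b → proj₁ a ≡ proj₁ b
    σ-injective (e , e∈R) (e′ , e′∈R) eq with true⇒witness (cycle-edge? e) e∈R | true⇒witness (cycle-edge? e′) e′∈R
    ... | i , j , s , jn | i′ , j′ , s′ , jn′
          with toℕ-injective {i = i} {j = i′} (nth-injective cs c₀ cs! (toℕ i) (toℕ i′) (toℕ<length-cs i) (toℕ<length-cs i′) eq)
    ... | refl with CycSucc-functional s s′
    ... | refl = Joins-unique {e} {e′} jn jn′
    nth-closed : ∀ (i : Fin K) → nth closed x (toℕ i) ≡ f i
    nth-closed i = nth-++ˡ (x ∷ xs) (x ∷ []) x (toℕ i) (FP.toℕ<n i)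
    nth-closed-suc : ∀ (i j : Fin K) → CycSucc i j → nth closed x (suc (toℕ i)) ≡ f j
    nth-closed-suc i j (inj₁ j≡1+i) = trans (cong (nth closed x) (sym j≡1+i)) (nth-closed j)
    nth-closed-suc i j (inj₂ (i≡last , j≡0)) rewrite i≡last | j≡0 = nth-++ʳ (x ∷ xs) (x ∷ []) x
    σ-member : ∀ a → proj₁ a ∈ₑ E (σ a)
    σ-member (e , e∈R) with true⇒witness (cycle-edge? e) e∈R
    ... | i , j , s , jn =
      Walk-nth w x c₀ (toℕ i) (subst (suc (toℕ i) <_) (sym length-closed) (s≤s (FP.toℕ<n i))) e
        (subst₂ (Joins e) (sym (nth-closed i)) (sym (nth-closed-suc i j s)) jn)

  record Route (a b : Fin n) : Set where
    constructor route
    field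
      vertices : List (Fin n)
      colours : List (Fin k)
      walk : Walk vertices colours
      starts : ∃ λ t → vertices ≡ a ∷ t
      ends : ∃ λ s → vertices ≡ s ++ b ∷ []
  open Route public

  start∈ : ∀ {a b} (P : Route a b) → a ∈ vertices P
  start∈ P = subst (_ ∈_) (sym (proj₂ (starts P))) (here refl)

  end∈ : ∀ {a b} (P : Route a b) → b ∈ vertices P
  end∈ P = subst (_ ∈_) (sym (proj₂ (ends P))) (∈P.∈-++⁺ʳ (proj₁ (ends P)) (here refl))

  two-vertex-route : ∀ {a b} (P : Route a b) → length (vertices P) ≡ 2 → ∃ λ c → c ∈ colours P × Links c a b
  two-vertex-route (route _ _ (end _) _ _) ()
  two-vertex-route (route _ _ (step _ (step _ _)) _ _) ()
  two-vertex-route (route _ (c ∷ []) (step {x} ab (end _)) (_ , refl) (s , ends≡)) _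
    with LP.∷ʳ-injectiveʳ (x ∷ []) s ends≡
  ... | refl = c , here refl , ab

  edge-route : ∀ {a b c} → Links c a b → Route a b
  edge-route {a} {b} {c} ab = route (a ∷ b ∷ []) (c ∷ []) (step ab (end b)) (_ , refl) (a ∷ [] , refl)

  _++ᴿ_ : ∀ {a b c} → Route a b → Route b c → Route a c
  _++ᴿ_ {a} {b} {c} (route vs₁ cs₁ w₁ (t₁ , h₁) (s₁ , l₁)) (route vs₂ cs₂ w₂ (t₂ , h₂) (s₂ , l₂)) =
    route (s₁ ++ vs₂) (cs₁ ++ cs₂)
      (subst (λ z → Walk (s₁ ++ z) (cs₁ ++ cs₂)) (sym h₂)
        (Walk-++ s₁ (subst (λ z → Walk z cs₁) l₁ w₁) (subst (λ z → Walk z cs₂) h₂ w₂)))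
      (starts-++ s₁ h₁ l₁) (s₁ ++ s₂ , trans (cong (s₁ ++_) l₂) (sym (LP.++-assoc s₁ s₂ (c ∷ []))))
    where
    starts-++ : ∀ s₁ → vs₁ ≡ a ∷ t₁ → vs₁ ≡ s₁ ++ b ∷ [] → ∃ λ t → s₁ ++ vs₂ ≡ a ∷ t
    starts-++ [] e₁ e₂ with trans (sym e₁) e₂
    ... | refl = t₂ , h₂
    starts-++ (q ∷ s) e₁ e₂ with trans (sym e₁) e₂
    ... | refl = s ++ vs₂ , refl

  ∈-++ᴿ⁻ : ∀ {a b c} (P : Route a b) (Q : Route b c) {x} → x ∈ vertices (P ++ᴿ Q) → x ∈ vertices P ⊎ x ∈ vertices Q
  ∈-++ᴿ⁻ (route _ _ _ _ (s₁ , refl)) Q x∈ with ∈P.∈-++⁻ s₁ x∈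
  ... | inj₁ p = inj₁ (∈P.∈-++⁺ˡ p)
  ... | inj₂ p = inj₂ p

  Unique-++ᴿ : ∀ {a b c} (P : Route a b) (Q : Route b c) → Unique (vertices P) → Unique (vertices Q) →
               (∀ {x} → x ∈ vertices P → x ∈ vertices Q → x ≡ b) → Unique (vertices (P ++ᴿ Q))
  Unique-++ᴿ (route _ _ _ _ (s₁ , refl)) Q P! Q! meet with Unique-++⁻ s₁ P!
  ... | s₁! , _ , s₁#b = UniqueP.++⁺ s₁! Q! (λ (x∈s₁ , x∈Q) → s₁#b (x∈s₁ , here (meet (∈P.∈-++⁺ˡ x∈s₁) x∈Q)))

  length-++ᴿ : ∀ {a b c} (P : Route a b) (Q : Route b c) →
               suc (length (vertices (P ++ᴿ Q))) ≡ length (vertices P) + length (vertices Q)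
  length-++ᴿ (route _ _ _ _ (s₁ , refl)) Q =
    trans (cong suc (LP.length-++ s₁))
          (sym (cong (_+ length (vertices Q)) (trans (LP.length-++ s₁) (ℕP.+-comm (length s₁) 1))))

  reverseᴿ : ∀ {a b} → Route a b → Route b a
  reverseᴿ {a} {b} (route vs cs w (t , h) (s , l)) =
    route (reverse vs) (reverse cs) (Walk-reverse w)
      (reverse s , trans (cong reverse l) (LP.reverse-++ s (b ∷ [])))
      (reverse t , trans (cong reverse h) (LP.unfold-reverse a t))

  route+link⇒rainbow-cycle : ∀ {a b c} (P : Route a b) → Unique (vertices P) → 3 ≤ length (vertices P) →
                             Unique (colours P ++ c ∷ []) → Links c b a → HasRainbowCycle E
  route+link⇒rainbow-cycle (route vs cs w (t , h) ([] , refl)) _ (s≤s ()) _ _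
  route+link⇒rainbow-cycle {a} {b} {c} (route vs cs w (t , h) (q ∷ ws , l)) P! 3≤ cs! ba with trans (sym h) l
  ... | refl =
    closed-walk⇒rainbow-cycle a (ws ++ b ∷ []) (cs ++ c ∷ []) (subst Unique l P!)
      (subst (2 ≤_) (sym length-ws+b)
        (ℕP.≤-pred (subst (3 ≤_) (trans (cong length l) (cong suc length-ws+b)) 3≤)))
      cs!
      (subst (λ z → Walk z (cs ++ c ∷ [])) (cong (a ∷_) (sym (LP.++-assoc ws (b ∷ []) (a ∷ []))))
        (Walk-++ (a ∷ ws) (subst (λ z → Walk z cs) l w) (step ba (end a))))
    where
    length-ws+b : length (ws ++ b ∷ []) ≡ suc (length ws)
    length-ws+b = trans (LP.length-++ ws) (ℕP.+-comm (length ws) 1)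

-- Rainbow trees

module Trees {n k : ℕ} (E : Fin k → EdgeSet n) (r : Fin n) where
  open Edges {n}
  open Walks E
  open import Data.List.Membership.DecPropositional (FP._≟_ {n}) using (_∈?_)

  -- chain z is the tree path z, parent z, …, r.
  record RainbowTree (In : Fin n → Set) : Set where
    field
      parent : Fin n → Fin n
      colour : Fin n → Fin k
      chain : Fin n → List (Fin n)
      chain-root : chain r ≡ r ∷ []
      chain-step : ∀ z → In z → z ≢ r → chain z ≡ z ∷ chain (parent z)
      chain-unique : ∀ z → In z → Unique (chain z)
      parent∈ : ∀ z → In z → In (parent z)
      links-parent : ∀ z → In z → z ≢ r → Links (colour z) z (parent z)
      colour-injective : ∀ z z′ → In z → In z′ → z ≢ r → z′ ≢ r → colour z ≡ colour z′ → z ≡ z′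

  module TreeLemmas {In : Fin n → Set} (T : RainbowTree In) where
    open RainbowTree T public

    chain-head : ∀ z → In z → ∃ λ t → chain z ≡ z ∷ t
    chain-head z iz with z FP.≟ r
    ... | yes refl = [] , chain-root
    ... | no z≢r = chain (parent z) , chain-step z iz z≢r

    ∈chain-self : ∀ z → In z → z ∈ chain z
    ∈chain-self z iz = subst (z ∈_) (sym (proj₂ (chain-head z iz))) (here refl)

    chain⊆′ : ∀ L z → chain z ≡ L → In z → ∀ {q} → q ∈ L → In q
    chain⊆′ (x ∷ L) z eq iz (here refl) with chain-head z iz
    ... | t , eq′ with trans (sym eq′) eq
    ... | refl = iz
    chain⊆′ (x ∷ L) z eq iz (there q∈) with z FP.≟ r
    chain⊆′ (x ∷ L) z eq iz (there q∈) | yes refl with trans (sym chain-root) eq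
    chain⊆′ (x ∷ []) z eq iz (there ()) | yes refl | refl
    chain⊆′ (x ∷ L) z eq iz (there q∈) | no z≢r with trans (sym (chain-step z iz z≢r)) eq
    ... | refl = chain⊆′ L (parent z) refl (parent∈ z iz) q∈

    chain⊆ : ∀ z → In z → ∀ {q} → q ∈ chain z → In q
    chain⊆ z iz = chain⊆′ (chain z) z refl iz

    root∈chain′ : ∀ L z → chain z ≡ L → In z → r ∈ L
    root∈chain′ [] z eq iz with chain-head z iz
    ... | t , eq′ with trans (sym eq′) eq
    ... | ()
    root∈chain′ (x ∷ L) z eq iz with z FP.≟ r
    ... | yes refl with trans (sym chain-root) eq
    ... | refl = here refl
    root∈chain′ (x ∷ L) z eq iz | no z≢r =
      there (root∈chain′ L (parent z) (LP.∷-injectiveʳ (trans (sym (chain-step z iz z≢r)) eq)) (parent∈ z iz))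

    root∈chain : ∀ z → In z → r ∈ chain z
    root∈chain z iz = root∈chain′ (chain z) z refl iz

    chain-suffix : ∀ pre z {u post} → In z → chain z ≡ pre ++ u ∷ post → chain u ≡ u ∷ post
    chain-suffix [] z iz eq with chain-head z iz
    ... | t , eq′ with trans (sym eq′) eq
    ... | refl = eq
    chain-suffix (q ∷ pre) z iz eq with z FP.≟ r
    ... | yes refl with trans (sym chain-root) eq
    chain-suffix (q ∷ []) z iz eq | yes refl | ()
    chain-suffix (q ∷ x ∷ pre) z iz eq | yes refl | ()
    chain-suffix (q ∷ pre) z iz eq | no z≢r =
      chain-suffix pre (parent z) (parent∈ z iz) (LP.∷-injectiveʳ (trans (sym (chain-step z iz z≢r)) eq))

    chain-split : ∀ z → In z → ∀ {u} → u ∈ chain z → ∃ λ pre → chain z ≡ pre ++ chain u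
    chain-split z iz u∈ with ∈P.∈-∃++ u∈
    ... | pre , post , eq = pre , trans eq (cong (pre ++_) (sym (chain-suffix pre z iz eq)))

    prefix≢root : ∀ pre z {u} → In z → In u → chain z ≡ pre ++ chain u → ∀ {q} → q ∈ pre → q ≢ r
    prefix≢root pre z iz iu eq q∈ refl with Unique-++⁻ pre (subst Unique eq (chain-unique z iz))
    ... | _ , _ , d = d (q∈ , root∈chain _ iu)

    segment-walk : ∀ pre z u → In z → In u → chain z ≡ pre ++ chain u → Walk (pre ++ u ∷ []) (map colour pre)
    segment-walk [] z u iz iu eq = end u
    segment-walk (q ∷ pre) z u iz iu eq with z FP.≟ r
    ... | yes refl with trans (sym chain-root) eq | chain-head u iu
    ... | e₁ | t , e₂ with trans e₁ (cong (q ∷_) (cong (pre ++_) e₂))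
    segment-walk (q ∷ []) z u iz iu eq | yes refl | e₁ | t , e₂ | ()
    segment-walk (q ∷ x ∷ pre) z u iz iu eq | yes refl | e₁ | t , e₂ | ()
    segment-walk (q ∷ pre) z u iz iu eq | no z≢r with LP.∷-injective (trans (sym (chain-step z iz z≢r)) eq)
    ... | refl , e′ = prepend pre e′ (segment-walk pre (parent z) u (parent∈ z iz) iu e′)
      where
      prepend : ∀ pre′ → chain (parent z) ≡ pre′ ++ chain u → Walk (pre′ ++ u ∷ []) (map colour pre′) →
             Walk (z ∷ pre′ ++ u ∷ []) (colour z ∷ map colour pre′)
      prepend [] e p with chain-head u iu
      ... | t , e₂ with chain-head (parent z) (parent∈ z iz)
      ... | t′ , e₃ with trans (sym e₃) (trans e e₂)
      ... | refl = step (links-parent z iz z≢r) p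
      prepend (q′ ∷ pre′) e p with chain-head (parent z) (parent∈ z iz)
      ... | t′ , e₃ with trans (sym e₃) e
      ... | refl = step (links-parent z iz z≢r) p

    segment-route : ∀ pre z u → In z → In u → chain z ≡ pre ++ chain u → Route z u
    segment-route pre z u iz iu eq =
      route (pre ++ u ∷ []) (map colour pre) (segment-walk pre z u iz iu eq) (starts-at-z pre eq) (pre , refl)
      where
      starts-at-z : ∀ pre → chain z ≡ pre ++ chain u → ∃ λ t → pre ++ u ∷ [] ≡ z ∷ t
      starts-at-z [] e with chain-head z iz | chain-head u iu
      ... | t , e₁ | t′ , e₂ with trans (sym e₁) (trans e e₂)
      ... | refl = [] , refl
      starts-at-z (q ∷ pre) e with chain-head z iz
      ... | t , e₁ with trans (sym e₁) e
      ... | refl = pre ++ u ∷ [] , refl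

    -- u is the first vertex of chain y that lies on chain x.
    record Meet (y x : Fin n) : Set where
      field
        py px : List (Fin n)
        u : Fin n
        iu : In u
        ey : chain y ≡ py ++ chain u
        ex : chain x ≡ px ++ chain u
        dj : Disjoint py (chain x)

    meet : ∀ y x → In y → In x → Meet y x
    meet y x iy ix with split-at-first (λ q → q ∈? chain x) (chain y)
                        (Any.map (λ { refl → root∈chain x ix }) (root∈chain y iy))
    ... | py , u , post , eq , u∈ , al with chain-suffix py y iy eq
    ... | ecu with chain-split x ix u∈
    ... | px , ex = record { py = py ; px = px ; u = u ; iu = chain⊆ y iy (subst (u ∈_) (sym eq) (∈P.∈-++⁺ʳ py (here refl)))
                           ; ey = trans eq (cong (py ++_) (sym ecu)) ; ex = ex
                           ; dj = λ (q∈ , q∈x) → All.lookup al q∈ q∈x }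

    prefix-chain⊇ : ∀ pre z u → In z → chain z ≡ pre ++ chain u → ∀ {q} → q ∈ pre → chain u ⊆ chain q
    prefix-chain⊇ pre z u iz eq q∈ w∈ with ∈P.∈-∃++ q∈
    ... | pre₁ , pre₂ , refl =
      subst (_ ∈_) (sym (chain-suffix pre₁ z iz (trans eq (LP.++-assoc pre₁ (_ ∷ pre₂) (chain u))))) (there (∈P.∈-++⁺ʳ pre₂ w∈))

    chain-to-root : ∀ z → In z → ∃ λ pre → chain z ≡ pre ++ chain r
    chain-to-root z iz = chain-split z iz (root∈chain z iz)

    chain-injective : ∀ a b → In a → In b → chain a ≡ chain b → a ≡ b
    chain-injective a b ia ib eq with chain-head a ia | chain-head b ib
    ... | _ , ea | _ , eb = LP.∷-injectiveˡ (trans (sym ea) (trans eq eb))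

    chain-parent : ∀ a b q → In a → In b → chain a ≡ q ∷ chain b → a ≢ r × parent a ≡ b
    chain-parent a b q ia ib eq with a FP.≟ r
    ... | yes refl with chain-head b ib
    ... | _ , eb with trans (sym chain-root) (trans eq (cong (q ∷_) eb))
    ... | ()
    chain-parent a b q ia ib eq | no a≢r =
      a≢r , chain-injective _ b (parent∈ a ia) ib (LP.∷-injectiveʳ (trans (sym (chain-step a ia a≢r)) eq))

  module NodeLists (default-colour : Fin k) where
    Node : Set
    Node = Fin n × Fin n × Fin k

    spanned : List Node → List (Fin n)
    spanned [] = r ∷ []
    spanned ((y , x , c) ∷ ns) = y ∷ spanned ns

    used : List Node → List (Fin k)
    used [] = []
    used ((y , x , c) ∷ ns) = c ∷ used ns

    parentᴺ : List Node → Fin n → Fin n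
    parentᴺ [] z = r
    parentᴺ ((y , x , c) ∷ ns) z with z FP.≟ y
    ... | yes _ = x
    ... | no _ = parentᴺ ns z

    colourᴺ : List Node → Fin n → Fin k
    colourᴺ [] z = default-colour
    colourᴺ ((y , x , c) ∷ ns) z with z FP.≟ y
    ... | yes _ = c
    ... | no _ = colourᴺ ns z

    chainᴺ : List Node → Fin n → List (Fin n)
    chainᴺ [] z = r ∷ []
    chainᴺ ((y , x , c) ∷ ns) z with z FP.≟ y
    ... | yes _ = y ∷ chainᴺ ns x
    ... | no _ = chainᴺ ns z

    Valid : List Node → Set
    Valid [] = ⊤
    Valid ((y , x , c) ∷ ns) = Valid ns × y ∉ spanned ns × x ∈ spanned ns × Links c y x × c ∉ used ns

    root∈spanned : ∀ ns → r ∈ spanned ns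
    root∈spanned [] = here refl
    root∈spanned ((y , x , c) ∷ ns) = there (root∈spanned ns)

    chainᴺ-extend : ∀ y x c ns → y ∉ spanned ns → ∀ z → z ∈ spanned ns → chainᴺ ((y , x , c) ∷ ns) z ≡ chainᴺ ns z
    chainᴺ-extend y x c ns y∉ z z∈ with z FP.≟ y
    ... | yes refl = ⊥-elim (y∉ z∈)
    ... | no _ = refl

    ∈spanned-tail : ∀ {y ns z} → z ∈ y ∷ spanned ns → z ≢ y → z ∈ spanned ns
    ∈spanned-tail (here refl) z≢y = ⊥-elim (z≢y refl)
    ∈spanned-tail (there p) _ = p

    chainᴺ-root : ∀ ns → Valid ns → chainᴺ ns r ≡ r ∷ []
    chainᴺ-root [] valid = refl
    chainᴺ-root ((y , x , c) ∷ ns) (valid , y∉ , _) = trans (chainᴺ-extend y x c ns y∉ r (root∈spanned ns)) (chainᴺ-root ns valid)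

    parentᴺ∈ : ∀ ns → Valid ns → ∀ z → z ∈ spanned ns → parentᴺ ns z ∈ spanned ns
    parentᴺ∈ [] valid z z∈ = here refl
    parentᴺ∈ ((y , x , c) ∷ ns) (valid , y∉ , x∈ , _) z z∈ with z FP.≟ y
    ... | yes _ = there x∈
    ... | no z≢y = there (parentᴺ∈ ns valid z (∈spanned-tail z∈ z≢y))

    chainᴺ-step : ∀ ns → Valid ns → ∀ z → z ∈ spanned ns → z ≢ r → chainᴺ ns z ≡ z ∷ chainᴺ ns (parentᴺ ns z)
    chainᴺ-step [] valid z (here refl) z≢r = ⊥-elim (z≢r refl)
    chainᴺ-step ((y , x , c) ∷ ns) (valid , y∉ , x∈ , _) z z∈ z≢r with z FP.≟ y
    ... | yes refl = cong (z ∷_) (sym (chainᴺ-extend y x c ns y∉ x x∈))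
    ... | no z≢y = trans (chainᴺ-step ns valid z (∈spanned-tail z∈ z≢y) z≢r)
                     (cong (z ∷_) (sym (chainᴺ-extend y x c ns y∉ (parentᴺ ns z) (parentᴺ∈ ns valid z (∈spanned-tail z∈ z≢y)))))

    chainᴺ⊆ : ∀ ns → Valid ns → ∀ z → z ∈ spanned ns → ∀ {q} → q ∈ chainᴺ ns z → q ∈ spanned ns
    chainᴺ⊆ [] valid z z∈ q∈ = q∈
    chainᴺ⊆ ((y , x , c) ∷ ns) (valid , y∉ , x∈ , _) z z∈ q∈ with z FP.≟ y
    chainᴺ⊆ ((y , x , c) ∷ ns) (valid , y∉ , x∈ , _) z z∈ (here refl) | yes _ = here refl
    chainᴺ⊆ ((y , x , c) ∷ ns) (valid , y∉ , x∈ , _) z z∈ (there q∈) | yes _ = there (chainᴺ⊆ ns valid x x∈ q∈)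
    ... | no z≢y = there (chainᴺ⊆ ns valid z (∈spanned-tail z∈ z≢y) q∈)

    chainᴺ-unique : ∀ ns → Valid ns → ∀ z → z ∈ spanned ns → Unique (chainᴺ ns z)
    chainᴺ-unique [] valid z z∈ = All.[] ∷ []
    chainᴺ-unique ((y , x , c) ∷ ns) (valid , y∉ , x∈ , _) z z∈ with z FP.≟ y
    ... | yes _ =
      All.tabulate (λ q∈ eq → y∉ (subst (_∈ spanned ns) (sym eq) (chainᴺ⊆ ns valid x x∈ q∈))) ∷ chainᴺ-unique ns valid x x∈
    ... | no z≢y = chainᴺ-unique ns valid z (∈spanned-tail z∈ z≢y)

    linksᴺ : ∀ ns → Valid ns → ∀ z → z ∈ spanned ns → z ≢ r → Links (colourᴺ ns z) z (parentᴺ ns z)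
    linksᴺ [] valid z (here refl) z≢r = ⊥-elim (z≢r refl)
    linksᴺ ((y , x , c) ∷ ns) (valid , y∉ , x∈ , yx , _) z z∈ z≢r with z FP.≟ y
    ... | yes refl = yx
    ... | no z≢y = linksᴺ ns valid z (∈spanned-tail z∈ z≢y) z≢r

    colourᴺ∈used : ∀ ns → Valid ns → ∀ z → z ∈ spanned ns → z ≢ r → colourᴺ ns z ∈ used ns
    colourᴺ∈used [] valid z (here refl) z≢r = ⊥-elim (z≢r refl)
    colourᴺ∈used ((y , x , c) ∷ ns) (valid , y∉ , x∈ , yx , _) z z∈ z≢r with z FP.≟ y
    ... | yes refl = here refl
    ... | no z≢y = there (colourᴺ∈used ns valid z (∈spanned-tail z∈ z≢y) z≢r)

    colourᴺ-injective : ∀ ns → Valid ns → ∀ z z′ → z ∈ spanned ns → z′ ∈ spanned ns → z ≢ r → z′ ≢ r →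
                        colourᴺ ns z ≡ colourᴺ ns z′ → z ≡ z′
    colourᴺ-injective [] valid z z′ (here refl) _ z≢r _ _ = ⊥-elim (z≢r refl)
    colourᴺ-injective ((y , x , c) ∷ ns) (valid , y∉ , x∈ , yx , c∉) z z′ z∈ z′∈ z≢r z′≢r eq with z FP.≟ y | z′ FP.≟ y
    ... | yes refl | yes refl = refl
    ... | yes refl | no z′≢y =
      ⊥-elim (c∉ (subst (_∈ used ns) (sym eq) (colourᴺ∈used ns valid z′ (∈spanned-tail z′∈ z′≢y) z′≢r)))
    ... | no z≢y | yes refl = ⊥-elim (c∉ (subst (_∈ used ns) eq (colourᴺ∈used ns valid z (∈spanned-tail z∈ z≢y) z≢r)))
    ... | no z≢y | no z′≢y =
      colourᴺ-injective ns valid z z′ (∈spanned-tail z∈ z≢y) (∈spanned-tail z′∈ z′≢y) z≢r z′≢r eq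

    spanned-unique : ∀ ns → Valid ns → Unique (spanned ns)
    spanned-unique [] valid = All.[] ∷ []
    spanned-unique ((y , x , c) ∷ ns) (valid , y∉ , _) =
      All.tabulate (λ q∈ eq → y∉ (subst (_∈ spanned ns) (sym eq) q∈)) ∷ spanned-unique ns valid

    length-spanned : ∀ ns → length (spanned ns) ≡ suc (length (used ns))
    length-spanned [] = refl
    length-spanned ((y , x , c) ∷ ns) = cong suc (length-spanned ns)

    toTree : ∀ ns → Valid ns → RainbowTree (λ z → z ∈ spanned ns)
    toTree ns valid = record
      { parent = parentᴺ ns ; colour = colourᴺ ns ; chain = chainᴺ ns ; chain-root = chainᴺ-root ns valid
      ; chain-step = chainᴺ-step ns valid ; chain-unique = chainᴺ-unique ns valid ; parent∈ = parentᴺ∈ ns valid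
      ; links-parent = linksᴺ ns valid
      ; colour-injective = colourᴺ-injective ns valid }

  module TreeRoutes {In : Fin n → Set} (T : RainbowTree In) where
    open TreeLemmas T

    segment-unique : ∀ pre z u → In z → In u → chain z ≡ pre ++ chain u → Unique (pre ++ u ∷ [])
    segment-unique pre z u iz iu eq with Unique-++⁻ pre (subst Unique eq (chain-unique z iz)) | chain-head u iu
    ... | up , _ , d | t , eu = UniqueP.++⁺ up (All.[] ∷ []) (λ { (q∈ , here refl) → d (q∈ , subst (u ∈_) (sym eu) (here refl)) })

    prefix∈ : ∀ pre z u → In z → chain z ≡ pre ++ chain u → ∀ {q} → q ∈ pre → In q
    prefix∈ pre z u iz eq q∈ = chain⊆ z iz (subst (_ ∈_) (sym eq) (∈P.∈-++⁺ˡ q∈))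

    module _ (y x : Fin n) (iy : In y) (ix : In x) where
      L : Meet y x
      L = meet y x iy ix
      open Meet L

      tree-route : Route y x
      tree-route = _++ᴿ_ (segment-route py y u iy iu ey) (reverseᴿ (segment-route px x u ix iu ex))

      tree-route-∈ : ∀ {q} → q ∈ vertices tree-route → q ∈ py ⊎ q ≡ u ⊎ q ∈ px
      tree-route-∈ {q} q∈ with ∈P.∈-++⁻ py q∈
      ... | inj₁ p = inj₁ p
      ... | inj₂ p with ∈P.∈-++⁻ px (AnyP.reverse⁻ p)
      ... | inj₁ p′ = inj₂ (inj₂ p′)
      ... | inj₂ (here refl) = inj₂ (inj₁ refl)

      tree-route-unique : Unique (vertices tree-route)
      tree-route-unique = Unique-++ᴿ (segment-route py y u iy iu ey) (reverseᴿ (segment-route px x u ix iu ex))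
               (segment-unique py y u iy iu ey) (Unique-reverse (segment-unique px x u ix iu ex)) common
        where
        common : ∀ {q} → q ∈ py ++ u ∷ [] → q ∈ reverse (px ++ u ∷ []) → q ≡ u
        common {q} q1 q2 with ∈P.∈-++⁻ py q1
        ... | inj₂ (here refl) = refl
        ... | inj₁ p = ⊥-elim (dj (p , subst (q ∈_) (sym ex) (helper (AnyP.reverse⁻ {xs = px ++ u ∷ []} q2))))
          where
          helper : ∀ {q} → q ∈ px ++ u ∷ [] → q ∈ px ++ chain u
          helper m with ∈P.∈-++⁻ px m | chain-head u iu
          ... | inj₁ p′ | _ = ∈P.∈-++⁺ˡ p′
          ... | inj₂ (here refl) | t , eu = ∈P.∈-++⁺ʳ px {ys = chain u} (subst (u ∈_) (sym eu) (here refl))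

      py∈ : ∀ {q} → q ∈ py → In q × q ≢ r
      py∈ q∈ = prefix∈ py y u iy ey q∈ , prefix≢root py y iy iu ey q∈
      px∈ : ∀ {q} → q ∈ px → In q × q ≢ r
      px∈ q∈ = prefix∈ px x u ix ex q∈ , prefix≢root px x ix iu ex q∈

      tree-route-colours-unique : Unique (colours tree-route)
      tree-route-colours-unique =
        UniqueP.++⁺ (Unique-map-injectiveOn colour (proj₁ (Unique-++⁻ py (subst Unique ey (chain-unique y iy)))) (All.tabulate py∈) inj)
          (Unique-reverse (Unique-map-injectiveOn colour (proj₁ (Unique-++⁻ px (subst Unique ex (chain-unique x ix)))) (All.tabulate px∈) inj))
                  dcol
        where
        inj : ∀ {a b} → In a × a ≢ r → In b × b ≢ r → colour a ≡ colour b → a ≡ b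
        inj (ia , na) (ib , nb) = colour-injective _ _ ia ib na nb
        dcol : Disjoint (map colour py) (reverse (map colour px))
        dcol (c1 , c2) with ∈P.∈-map⁻ colour c1 | ∈P.∈-map⁻ colour (AnyP.reverse⁻ {xs = map colour px} c2)
        ... | a , a∈ , refl | b , b∈ , eq with inj (py∈ a∈) (px∈ b∈) eq
        ... | refl = dj (a∈ , subst (_ ∈_) (sym ex) (∈P.∈-++⁺ˡ b∈))

-- Families of stars at v and cycles without rainbow cycles

module Family {n k : ℕ} (E : Fin k → EdgeSet n) (v : Fin n)
  (star-or-cycle : ∀ i → IsStarAt v (E i) ⊎ IsCycle (E i))
  (no-rainbow : ¬ HasRainbowCycle E)
  (star-disjoint : ∀ i → IsStarAt v (E i) → ∀ j → j ≢ i → ∀ e → e ∈ₑ E i → E j e ≡ false) where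
  open Edges {n}
  open Walks E
  open import Data.List.Membership.DecPropositional (FP._≟_ {n}) using () renaming (_∈?_ to _∈ⱽ?_)
  open import Data.List.Membership.DecPropositional (FP._≟_ {k}) using () renaming (_∈?_ to _∈ᶜ?_)

  star-edge-unshared : ∀ i → IsStarAt v (E i) → ∀ j → j ≢ i → ∀ e → e ∈ₑ E i → e ∈ₑ E j → ⊥
  star-edge-unshared i star j j≢i e e∈i e∈j with trans (sym e∈j) (star-disjoint i star j j≢i e e∈i)
  ... | ()

  member? : ∀ i e → Dec (e ∈ₑ E i)
  member? i e = E i e Data.Bool.≟ true

  module CycleOf {i} (cycle : IsCycle (E i)) where
    K : ℕ
    K = proj₁ cycle
    f : Fin K → Fin n
    f = proj₁ (proj₂ cycle)
    private
      3≤K : 3 ≤ K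
      3≤K = proj₁ (proj₂ (proj₂ cycle))
      f-injective : ∀ a b → f a ≡ f b → a ≡ b
      f-injective = proj₁ (proj₂ (proj₂ (proj₂ cycle)))
      edges : ∀ e → e ∈ₑ E i ⇔ (∃[ a ] ∃[ b ] (CycSucc a b × Joins e (f a) (f b)))
      edges = proj₂ (proj₂ (proj₂ (proj₂ cycle)))

    cycle-edge : ∀ a b → CycSucc a b → Σ (Edge n) λ e → e ∈ₑ E i × Joins e (f a) (f b)
    cycle-edge a b s = e , Equivalence.from (edges e) (a , b , s , edge-between-joins (f a) (f b) fa≢fb) ,
                       edge-between-joins (f a) (f b) fa≢fb
      where
      fa≢fb : f a ≢ f b
      fa≢fb eq = CycSucc⇒≢ 3≤K s (f-injective a b eq)
      e : Edge n
      e = edge-between (f a) (f b) fa≢fb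

    cycle-edge-positions : ∀ e → e ∈ₑ E i → ∃ λ a → ∃ λ b → CycSucc a b × Joins e (f a) (f b)
    cycle-edge-positions e = Equivalence.to (edges e)

  member-within : ∀ u (S : Fin n → Set) → (∀ e → e ∈ₑ E u → ∀ x y → Joins e x y → S x → S y) →
                  ∀ e₀ → e₀ ∈ₑ E u → ∀ x₀ y₀ → Joins e₀ x₀ y₀ → S x₀ →
                  ∀ e → e ∈ₑ E u → ∀ x y → Joins e x y → S x
  member-within u S closed e₀ e₀∈ x₀ y₀ j₀ s₀ e e∈ x y jn with star-or-cycle u
  ... | inj₁ (at-v , _) = sx
    where
    sv : S v
    sv with Incident⇒Joins {e₀} (at-v e₀ e₀∈)
    ... | w , jw with Joins-ends {e = e₀} jw j₀
    ... | inj₁ (refl , _) = s₀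
    ... | inj₂ (refl , refl) = closed e₀ e₀∈ x₀ y₀ j₀ s₀
    sx : S x
    sx with Incident⇒Joins {e} (at-v e e∈)
    ... | w , jw with Joins-ends {e = e} jw jn
    ... | inj₁ (refl , refl) = sv
    ... | inj₂ (refl , refl) = closed e e∈ v x jw sv
  ... | inj₂ cycle = sx
    where
    open CycleOf cycle
    step-S : ∀ a b → CycSucc a b → S (f a) → S (f b)
    step-S a b s sa with cycle-edge a b s
    ... | e′ , e′∈ , j′ = closed e′ e′∈ (f a) (f b) j′ sa
    everywhere : ∀ t → S (f t)
    everywhere with cycle-edge-positions e₀ e₀∈
    ... | a , b , s , ja with Joins-ends {e = e₀} j₀ ja
    ... | inj₁ (refl , refl) = CycSucc-everywhere (λ t → S (f t)) step-S a s₀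
    ... | inj₂ (refl , refl) = CycSucc-everywhere (λ t → S (f t)) step-S b s₀
    sx : S x
    sx with cycle-edge-positions e e∈
    ... | a , b , s , ja with Joins-ends {e = e} jn ja
    ... | inj₁ (refl , refl) = everywhere a
    ... | inj₂ (refl , refl) = everywhere b

  module InsideTree (r : Fin n) {In : Fin n → Set} (T : Trees.RainbowTree E r In) (In? : Decidable In) where
    open Trees E r
    open TreeLemmas T
    open TreeRoutes T

    UnusedColour : Fin k → Set
    UnusedColour u = ∀ z → In z → z ≢ r → colour z ≢ u

    TreeEdge : Edge n → Set
    TreeEdge e = Σ (Fin n) λ z → In z × z ≢ r × Joins e z (parent z)

    TreeEdge? : ∀ e → Dec (TreeEdge e)
    TreeEdge? e = any? (λ z → In? z ×-dec (¬? (z FP.≟ r) ×-dec Joins? e z (parent z)))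

    chord⇒rainbow-cycle : ∀ {u} → UnusedColour u → ∀ e → e ∈ₑ E u → ¬ TreeEdge e →
                          In (proj₁ e) → In (proj₁ (proj₂ e)) → HasRainbowCycle E
    chord⇒rainbow-cycle {u} unused e@(i , j , _) e∈u non-tree ii ij =
      route+link⇒rainbow-cycle P (tree-route-unique i j ii ij) 3≤|P| colours!
        (Links-via e∈u (Joins-sym {e} jn))
      where
      jn : Joins e i j
      jn = Joins-own-ends e
      P : Route i j
      P = tree-route i j ii ij
      open Meet (meet i j ii ij) renaming (u to w; iu to iw)
      |P| : length (vertices P) ≡ length py + suc (length px)
      |P| = trans (LP.length-++ py) (cong (length py +_) (trans (LP.length-reverse (px ++ w ∷ []))
              (trans (LP.length-++ px) (ℕP.+-comm (length px) 1))))
      -- Two vertices at tree distance at most one are equal or joined by a tree edge.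
      long : ∀ a b → chain i ≡ a ++ chain w → chain j ≡ b ++ chain w → 3 ≤ length a + suc (length b)
      long [] [] ei ej =
        ⊥-elim (Joins⇒≢ {e} jn (trans (chain-injective i w ii iw ei) (sym (chain-injective j w ij iw ej))))
      long [] (q ∷ []) ei ej
        with chain-parent j i q ij ii (trans ej (cong (λ z → q ∷ chain z) (sym (chain-injective i w ii iw ei))))
      ... | j≢r , parent-j = ⊥-elim (non-tree (j , ij , j≢r , subst (Joins e j) (sym parent-j) (Joins-sym {e} jn)))
      long (q ∷ []) [] ei ej
        with chain-parent i j q ii ij (trans ei (cong (λ z → q ∷ chain z) (sym (chain-injective j w ij iw ej))))
      ... | i≢r , parent-i = ⊥-elim (non-tree (i , ii , i≢r , subst (Joins e i) (sym parent-i) jn))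
      long [] (_ ∷ _ ∷ _) _ _ = s≤s (s≤s (s≤s z≤n))
      long (_ ∷ []) (_ ∷ _) _ _ = s≤s (s≤s (s≤s z≤n))
      long (_ ∷ _ ∷ a) b _ _ = s≤s (s≤s (ℕP.≤-trans (s≤s z≤n) (ℕP.m≤n+m (suc (length b)) (length a))))
      3≤|P| : 3 ≤ length (vertices P)
      3≤|P| = subst (3 ≤_) (sym |P|) (long py px ey ex)
      u∉P : ∀ {c} → c ∈ colours P → c ≢ u
      u∉P c∈ with ∈P.∈-++⁻ (map colour py) c∈
      ... | inj₁ c∈py with ∈P.∈-map⁻ colour c∈py
      ...   | q , q∈ , refl = unused q (proj₁ (py∈ i j ii ij q∈)) (proj₂ (py∈ i j ii ij q∈))
      u∉P c∈ | inj₂ c∈px with ∈P.∈-map⁻ colour (AnyP.reverse⁻ {xs = map colour px} c∈px)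
      ...   | q , q∈ , refl = unused q (proj₁ (px∈ i j ii ij q∈)) (proj₂ (px∈ i j ii ij q∈))
      colours! : Unique (colours P ++ u ∷ [])
      colours! = UniqueP.++⁺ (tree-route-colours-unique i j ii ij) ([] ∷ [])
                   λ { (c∈ , here refl) → u∉P c∈ refl }

    -- A star would share its edge with the tree colour; a cycle is rainbow via the tree colours.
    tree-member⇒⊥ : ∀ {u} → UnusedColour u → (∀ e → e ∈ₑ E u → TreeEdge e) → ⊥
    tree-member⇒⊥ {u} unused tree with star-or-cycle u
    ... | inj₁ star@(_ , e₁ , _ , _ , e₁∈ , _) with tree e₁ e₁∈
    ... | z , iz , z≢r , jz = star-edge-unshared u star (colour z) (unused z iz z≢r) e₁ e₁∈ (links-parent z iz z≢r e₁ jz)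
    tree-member⇒⊥ {u} unused tree | inj₂ cycle = no-rainbow (E u , (σ , σ-injective , σ-member) , cycle)
      where
      σ : Σ (Edge n) (λ e → e ∈ₑ E u) → Fin k
      σ (e , e∈) = colour (proj₁ (tree e e∈))
      σ-injective : ∀ a b → σ a ≡ σ b → proj₁ a ≡ proj₁ b
      σ-injective (e , e∈) (e′ , e′∈) eq with tree e e∈ | tree e′ e′∈
      ... | z , iz , z≢r , jz | z′ , iz′ , z′≢r , jz′ with colour-injective z z′ iz iz′ z≢r z′≢r eq
      ... | refl = Joins-unique {e} {e′} jz jz′
      σ-member : ∀ a → proj₁ a ∈ₑ E (σ a)
      σ-member (e , e∈) with tree e e∈
      ... | z , iz , z≢r , jz = links-parent z iz z≢r e jz

    unused-member-inside-tree : ∀ u → UnusedColour u → (∀ e → e ∈ₑ E u → ∀ x y → Joins e x y → In x) → ⊥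
    unused-member-inside-tree u unused inside with any-edge? (λ e → member? u e ×-dec ¬? (TreeEdge? e))
    ... | yes (e , e∈ , non-tree) =
      no-rainbow (chord⇒rainbow-cycle unused e e∈ non-tree (inside e e∈ _ _ jn) (inside e e∈ _ _ (Joins-sym {e} jn)))
      where
      jn : Joins e (proj₁ e) (proj₁ (proj₂ e))
      jn = Joins-own-ends e
    ... | no no-chord = tree-member⇒⊥ unused tree
      where
      tree : ∀ e → e ∈ₑ E u → TreeEdge e
      tree e e∈ with TreeEdge? e
      ... | yes te = te
      ... | no nte = ⊥-elim (no-chord (e , e∈ , nte))

  LivesIn : List (Fin n) → Fin k → Set
  LivesIn W j = ∀ e → e ∈ₑ E j → ∀ x y → Joins e x y → x ∈ W

  record Crowded (W : List (Fin n)) (J : List (Fin k)) : Set where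
    field
      W! : Unique W
      J! : Unique J
      |W|≤|J| : length W ≤ length J
      inhabited : ∃ (_∈ W)
      lives : ∀ j → j ∈ J → LivesIn W j

  module Growth (r : Fin n) (default-colour : Fin k) (W : List (Fin n)) (J : List (Fin k))
    (W! : Unique W) (J! : Unique J) (r∈W : r ∈ W) (lives : ∀ j → j ∈ J → LivesIn W j)
    (|W|≤1+|J| : length W ≤ suc (length J))
    (smaller-uncrowded : ∀ W′ J′ → length W′ < length W → ¬ Crowded W′ J′) where
    open Trees E r
    open NodeLists default-colour

    SpanningTree : Set
    SpanningTree = Σ (List Node) λ ns → Valid ns × W ⊆ spanned ns × spanned ns ⊆ W × used ns ⊆ J

    unused : List Node → List (Fin k)
    unused ns = filter (λ c → ¬? (c ∈ᶜ? used ns)) J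

    unspanned : List Node → List (Fin n)
    unspanned ns = filter (λ z → ¬? (z ∈ⱽ? spanned ns)) W

    ∈unused⁻ : ∀ ns {u} → u ∈ unused ns → u ∈ J × u ∉ used ns
    ∈unused⁻ ns = ∈P.∈-filter⁻ (λ c → ¬? (c ∈ᶜ? used ns))

    Crossing : List Node → Edge n → Set
    Crossing ns e = Σ (Fin n) λ x → Σ (Fin n) λ y → Joins e x y × x ∈ spanned ns × y ∉ spanned ns

    Crossing? : ∀ ns e → Dec (Crossing ns e)
    Crossing? ns e = any? (λ x → any? (λ y → Joins? e x y ×-dec (x ∈ⱽ? spanned ns ×-dec ¬? (y ∈ⱽ? spanned ns))))

    Touching : List Node → Edge n → Set
    Touching ns e = Σ (Fin n) λ x → Σ (Fin n) λ y → Joins e x y × x ∈ spanned ns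

    Touching? : ∀ ns e → Dec (Touching ns e)
    Touching? ns e = any? (λ x → any? (λ y → Joins? e x y ×-dec (x ∈ⱽ? spanned ns)))

    length-unspanned≤length-unused : ∀ ns → Valid ns → spanned ns ⊆ W → length (unspanned ns) ≤ length (unused ns)
    length-unspanned≤length-unused ns valid spanned⊆W = ℕP.+-cancelˡ-≤ (suc c) w′ u (begin
        suc c + w′       ≤⟨ ℕP.+-monoˡ-≤ w′ 1+c≤b ⟩
        b + w′           ≡⟨ length-filter+length-filter-∁ (_∈ⱽ? spanned ns) W ⟩
        length W         ≤⟨ |W|≤1+|J| ⟩
        suc (length J)   ≡⟨ cong suc (length-filter+length-filter-∁ (_∈ᶜ? used ns) J) ⟨
        suc (a + u)      ≤⟨ s≤s (ℕP.+-monoˡ-≤ u a≤c) ⟩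
        suc (c + u)      ∎)
      where
      open ℕP.≤-Reasoning
      c u w′ a b : ℕ
      c = length (used ns)
      u = length (unused ns)
      w′ = length (unspanned ns)
      a = length (filter (_∈ᶜ? used ns) J)
      b = length (filter (_∈ⱽ? spanned ns) W)
      a≤c : a ≤ c
      a≤c = Unique⇒length≤ (UniqueP.filter⁺ (_∈ᶜ? used ns) J!) (λ m → proj₂ (∈P.∈-filter⁻ (_∈ᶜ? used ns) {xs = J} m))
      1+c≤b : suc c ≤ b
      1+c≤b = subst (_≤ b) (length-spanned ns)
                (Unique⇒length≤ (spanned-unique ns valid) (λ m → ∈P.∈-filter⁺ (_∈ⱽ? spanned ns) (spanned⊆W m) m))

    CrossingColour : List Node → Fin k → Set
    CrossingColour ns u = ∃ λ e → e ∈ₑ E u × Crossing ns e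

    -- With no unused member crossing out of the tree, an unused member touching it lies inside
    -- it, and otherwise the unspanned part of W with the unused colours is crowded.
    stalled⇒⊥ : ∀ ns → Valid ns → spanned ns ⊆ W → ∀ {z₀} → z₀ ∈ W → z₀ ∉ spanned ns →
                ¬ Any (CrossingColour ns) (unused ns) → ⊥
    stalled⇒⊥ ns valid spanned⊆W z₀∈W z₀∉ no-crossing
      with Any.any? (λ u → any-edge? (λ e → member? u e ×-dec Touching? ns e)) (unused ns)
    ... | yes touching with find touching
    ... | u , u∈ , e₀ , e₀∈ , x₀ , y₀ , j₀ , x₀∈ =
      InsideTree.unused-member-inside-tree r (toTree ns valid) (_∈ⱽ? spanned ns) u unused-u
        (member-within u (_∈ spanned ns) closed e₀ e₀∈ x₀ y₀ j₀ x₀∈)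
      where
      unused-u : ∀ z → z ∈ spanned ns → z ≢ r → colourᴺ ns z ≢ u
      unused-u z z∈ z≢r eq = proj₂ (∈unused⁻ ns u∈) (subst (_∈ used ns) eq (colourᴺ∈used ns valid z z∈ z≢r))
      closed : ∀ e → e ∈ₑ E u → ∀ x y → Joins e x y → x ∈ spanned ns → y ∈ spanned ns
      closed e e∈ x y jn x∈ with y ∈ⱽ? spanned ns
      ... | yes y∈ = y∈
      ... | no y∉ = ⊥-elim (no-crossing (lose u∈ (e , e∈ , x , y , jn , x∈ , y∉)))
    stalled⇒⊥ ns valid spanned⊆W z₀∈W z₀∉ no-crossing | no no-touching =
      smaller-uncrowded (unspanned ns) (unused ns) shorter record
        { W! = UniqueP.filter⁺ _ W! ; J! = UniqueP.filter⁺ _ J!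
        ; |W|≤|J| = length-unspanned≤length-unused ns valid spanned⊆W
        ; inhabited = _ , ∈P.∈-filter⁺ _ z₀∈W z₀∉
        ; lives = lives-outside }
      where
      shorter : length (unspanned ns) < length W
      shorter = LP.filter-notAll _ W (Any.map (λ { refl r∉ → r∉ (root∈spanned ns) }) r∈W)
      lives-outside : ∀ j → j ∈ unused ns → LivesIn (unspanned ns) j
      lives-outside j j∈ e e∈ x y jn =
        ∈P.∈-filter⁺ _ (lives j (proj₁ (∈unused⁻ ns j∈)) e e∈ x y jn)
          (λ x∈ → no-touching (lose j∈ (e , e∈ , x , y , jn , x∈)))

    grow : ∀ fuel ns → Valid ns → spanned ns ⊆ W → used ns ⊆ J → length W ≤ fuel + length (spanned ns) → SpanningTree
    grow fuel ns valid spanned⊆W used⊆J bound with All.all? (_∈ⱽ? spanned ns) W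
    ... | yes all-spanned = ns , valid , All.lookup all-spanned , spanned⊆W , used⊆J
    ... | no some-unspanned with find (¬All⇒Any¬ (_∈ⱽ? spanned ns) W some-unspanned)
    grow zero ns valid spanned⊆W used⊆J bound | no _ | z₀ , z₀∈W , z₀∉ =
      ⊥-elim (ℕP.<-irrefl refl (ℕP.<-≤-trans (Unique⇒length< (spanned-unique ns valid) spanned⊆W z₀∈W z₀∉) bound))
    grow (suc fuel) ns valid spanned⊆W used⊆J bound | no _ | z₀ , z₀∈W , z₀∉
      with Any.any? (λ u → any-edge? (λ e → member? u e ×-dec Crossing? ns e)) (unused ns)
    ... | no no-crossing = ⊥-elim (stalled⇒⊥ ns valid spanned⊆W z₀∈W z₀∉ no-crossing)
    ... | yes crossing with find crossing
    ... | u , u∈ , e , e∈ , x , y , jn , x∈ , y∉ =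
      grow fuel ((y , x , u) ∷ ns) (valid , y∉ , x∈ , Links-via e∈ (Joins-sym {e} jn) , proj₂ (∈unused⁻ ns u∈))
        spanned′⊆W used′⊆J (subst (length W ≤_) (sym (ℕP.+-suc fuel _)) bound)
      where
      spanned′⊆W : spanned ((y , x , u) ∷ ns) ⊆ W
      spanned′⊆W (here refl) = lives u (proj₁ (∈unused⁻ ns u∈)) e e∈ y x (Joins-sym {e} jn)
      spanned′⊆W (there m) = spanned⊆W m
      used′⊆J : used ((y , x , u) ∷ ns) ⊆ J
      used′⊆J (here refl) = proj₁ (∈unused⁻ ns u∈)
      used′⊆J (there m) = used⊆J m

    spanning-tree : SpanningTree
    spanning-tree = grow (length W) [] tt (λ { (here refl) → r∈W }) (λ ()) (ℕP.m≤m+n (length W) 1)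

  -- A rainbow spanning tree of W uses at most |W| - 1 < |J| colours, leaving a member of J inside it.
  no-crowded-subfamily : ∀ W J → ¬ Crowded W J
  no-crowded-subfamily W J = go (length W) W J ℕP.≤-refl
    where
    go : ∀ d W J → length W ≤ d → ¬ Crowded W J
    go zero W J |W|≤0 crowded with Crowded.inhabited crowded
    ... | _ , z∈ = ℕP.<-irrefl refl (ℕP.<-≤-trans (∈P.∈-length z∈) |W|≤0)
    go (suc d) W [] _ crowded with Crowded.inhabited crowded
    ... | _ , z∈ = ℕP.<-irrefl refl (ℕP.<-≤-trans (∈P.∈-length z∈) (Crowded.|W|≤|J| crowded))
    go (suc d) W (j₀ ∷ J) |W|≤1+d crowded@record { W! = W! ; J! = J! ; |W|≤|J| = |W|≤|J| ; inhabited = w , w∈ ; lives = lives }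
      with Growth.spanning-tree w j₀ W (j₀ ∷ J) W! J! w∈ lives (ℕP.m≤n⇒m≤1+n |W|≤|J|)
             (λ W′ J′ shorter → go d W′ J′ (ℕP.≤-pred (ℕP.≤-trans shorter |W|≤1+d)))
    ... | ns , valid , W⊆spanned , spanned⊆W , _ with Unique⇒∃∉ FP._≟_ J! |used|<|J|
      where
      open Trees E w
      open NodeLists j₀
      |used|<|J| : length (used ns) < length (j₀ ∷ J)
      |used|<|J| = ℕP.≤-trans (subst (_≤ length W) (length-spanned ns) (Unique⇒length≤ (spanned-unique ns valid) spanned⊆W)) |W|≤|J|
    ... | u , u∈J , u∉used =
      InsideTree.unused-member-inside-tree w (toTree ns valid) (_∈ⱽ? spanned ns) u
        (λ z z∈ z≢w eq → u∉used (subst (_∈ used ns) eq (colourᴺ∈used ns valid z z∈ z≢w)))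
        (λ e e∈ x y jn → W⊆spanned (lives u u∈J e e∈ x y jn))
      where
      open Trees E w
      open NodeLists j₀

  rainbow-spanning-tree : (r : Fin n) → Fin k → n ≤ suc k →
                          Σ (Fin n → Set) λ In → Trees.RainbowTree E r In × (∀ z → In z)
  rainbow-spanning-tree r default-colour n≤1+k
    with Growth.spanning-tree r default-colour (allFin n) (allFin k) (UniqueP.allFin⁺ n) (UniqueP.allFin⁺ k) (∈P.∈-allFin r)
           (λ _ _ _ _ x _ _ → ∈P.∈-allFin x)
           (subst₂ _≤_ (sym (LP.length-tabulate id)) (cong suc (sym (LP.length-tabulate id))) n≤1+k)
           (λ W′ J′ _ → no-crowded-subfamily W′ J′)
  ... | ns , valid , all⊆spanned , _ = (_∈ spanned ns) , toTree ns valid , λ z → all⊆spanned (∈P.∈-allFin z)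
    where
    open Trees E r
    open NodeLists default-colour

-- The pocket around the star

module StarComponent {n k : ℕ} (E : Fin k → EdgeSet n) (v : Fin n)
  (star-or-cycle : ∀ i → IsStarAt v (E i) ⊎ IsCycle (E i))
  (no-rainbow : ¬ HasRainbowCycle E)
  (star-disjoint : ∀ i → IsStarAt v (E i) → ∀ j → j ≢ i → ∀ e → e ∈ₑ E i → E j e ≡ false)
  (c₁ : Fin k) (star₁ : IsStarAt v (E c₁))
  {In : Fin n → Set} (T : Trees.RainbowTree E v In) (spans : ∀ z → In z) where
  open Edges {n}
  open Walks E
  open Family E v star-or-cycle no-rainbow star-disjoint
  open Trees E v
  open TreeLemmas T
  open TreeRoutes T
  open import Data.List.Membership.DecPropositional (FP._≟_ {n}) using () renaming (_∈?_ to _∈ⱽ?_)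

  parent-≢ : ∀ z → z ≢ v → z ≢ parent z
  parent-≢ z z≢v z≡pz = UniqueP.Unique[x∷xs]⇒x∉xs (subst Unique (chain-step z (spans z) z≢v) (chain-unique z (spans z)))
                          (subst (_∈ chain (parent z)) (sym z≡pz) (∈chain-self (parent z) (spans (parent z))))

  tree-edge : ∀ z → z ≢ v → Edge n
  tree-edge z z≢v = edge-between z (parent z) (parent-≢ z z≢v)

  tree-edge-joins : ∀ z z≢v → Joins (tree-edge z z≢v) z (parent z)
  tree-edge-joins z z≢v = edge-between-joins z (parent z) (parent-≢ z z≢v)

  tree-edge-∈ : ∀ z z≢v → tree-edge z z≢v ∈ₑ E (colour z)
  tree-edge-∈ z z≢v = links-parent z (spans z) z≢v (tree-edge z z≢v) (tree-edge-joins z z≢v)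

  star-colour⇒parent≡v : ∀ z → z ≢ v → IsStarAt v (E (colour z)) → parent z ≡ v
  star-colour⇒parent≡v z z≢v (at-v , _) with Incident⇒Joins {tree-edge z z≢v} (at-v _ (tree-edge-∈ z z≢v))
  ... | _ , jv with Joins-ends {e = tree-edge z z≢v} jv (tree-edge-joins z z≢v)
  ... | inj₁ (v≡z , _) = ⊥-elim (z≢v (sym v≡z))
  ... | inj₂ (v≡pz , _) = sym v≡pz

  -- Otherwise E c₁ would be an unused member inside the spanning tree.
  vertex-of-c₁ : Σ (Fin n) λ a → a ≢ v × colour a ≡ c₁
  vertex-of-c₁ with any? (λ z → ¬? (z FP.≟ v) ×-dec (colour z FP.≟ c₁))
  ... | yes found = found
  ... | no none = ⊥-elim (InsideTree.unused-member-inside-tree v T (λ z → yes (spans z)) c₁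
                            (λ z _ z≢v eq → none (z , z≢v , eq)) (λ e _ x _ _ → spans x))

  a : Fin n
  a = proj₁ vertex-of-c₁

  a≢v : a ≢ v
  a≢v = proj₁ (proj₂ vertex-of-c₁)

  colour-a : colour a ≡ c₁
  colour-a = proj₂ (proj₂ vertex-of-c₁)

  parent-a : parent a ≡ v
  parent-a = star-colour⇒parent≡v a a≢v (subst (λ c → IsStarAt v (E c)) (sym colour-a) star₁)

  chain-a : chain a ≡ a ∷ v ∷ []
  chain-a = trans (chain-step a (spans a) a≢v) (cong (a ∷_) (trans (cong chain parent-a) chain-root))

  -- The edge a v is the tree edge of a, hence an edge of the star.
  edge-a-v-only-in-c₁ : ∀ {c} e → e ∈ₑ E c → Joins e a v → c ≡ c₁
  edge-a-v-only-in-c₁ {c} e e∈ jn with c FP.≟ c₁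
  ... | yes c≡c₁ = c≡c₁
  ... | no c≢c₁ = ⊥-elim (star-edge-unshared c₁ star₁ c c≢c₁ e
                    (subst (λ c → e ∈ₑ E c) colour-a
                      (Links-via (tree-edge-∈ a a≢v) (subst (Joins (tree-edge a a≢v) a) parent-a (tree-edge-joins a a≢v)) e jn)) e∈)

  root-route : ∀ x → Route x v
  root-route x = segment-route (proj₁ (chain-to-root x (spans x))) x v (spans x) (spans v) (proj₂ (chain-to-root x (spans x)))

  root-route-vertices : ∀ x → vertices (root-route x) ≡ chain x
  root-route-vertices x =
    sym (trans (proj₂ (chain-to-root x (spans x))) (cong (proj₁ (chain-to-root x (spans x)) ++_) chain-root))

  root-route-unique : ∀ x → Unique (vertices (root-route x))
  root-route-unique x = subst Unique (sym (root-route-vertices x)) (chain-unique x (spans x))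

  root-route-colours : ∀ x {c} → c ∈ colours (root-route x) → ∃ λ q → q ∈ chain x × q ≢ v × colour q ≡ c
  root-route-colours x c∈ with ∈P.∈-map⁻ colour c∈
  ... | q , q∈ , refl =
    q , subst (q ∈_) (sym eq) (∈P.∈-++⁺ˡ {ys = chain v} q∈) , prefix≢root pre x (spans x) (spans v) eq q∈ , refl
    where
    pre : List (Fin n)
    pre = proj₁ (chain-to-root x (spans x))
    eq : chain x ≡ pre ++ chain v
    eq = proj₂ (chain-to-root x (spans x))

  root-route-colours-unique : ∀ x → Unique (colours (root-route x))
  root-route-colours-unique x =
    Unique-map-injectiveOn {P = _≢ v} colour (proj₁ (Unique-++⁻ pre (subst Unique eq (chain-unique x (spans x)))))
      (All.tabulate (prefix≢root pre x (spans x) (spans v) eq))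
      (λ q≢v q′≢v → colour-injective _ _ (spans _) (spans _) q≢v q′≢v)
    where
    pre : List (Fin n)
    pre = proj₁ (chain-to-root x (spans x))
    eq : chain x ≡ pre ++ chain v
    eq = proj₂ (chain-to-root x (spans x))

  NotAColour : (Fin n → Set) → Fin k → Set
  NotAColour A c = ∀ z → A z → colour z ≢ c

  record OutsideRoute (A : Fin n → Set) (y : Fin n) : Set where
    field
      path : Route v y
      vertices! : Unique (vertices path)
      colours! : Unique (colours path)
      avoids : All (∁ A) (vertices path)
      avoids-colours : All (NotAColour A) (colours path)

  record Pocket : Set₁ where
    field
      A : Fin n → Set
      A? : Decidable A
      a∈A : A a
      A-below-a : ∀ z → A z → a ∈ chain z
      A-parent : ∀ z → A z → z ≢ a → A (parent z)
      outside-route : ∀ y → ¬ A y → OutsideRoute A y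

  size : Pocket → ℕ
  size S = length (filter (Pocket.A? S) (allFin n))

  Sealed : Pocket → Set
  Sealed S = ∀ w → A w → w ≢ a → ∀ e → e ∈ₑ E (colour w) → ∀ x y → Joins e x y → A x
    where open Pocket S

  module PocketLemmas (S : Pocket) where
    open Pocket S

    v∉A : ¬ A v
    v∉A v∈A with subst (a ∈_) chain-root (A-below-a v v∈A)
    ... | here a≡v = a≢v a≡v

    A⇒≢v : ∀ z → A z → z ≢ v
    A⇒≢v z z∈A refl = v∉A z∈A

    chain⊆A′ : ∀ L x → chain x ≡ L → A x → ∀ {q} → q ∈ L → q ≢ v → A q
    chain⊆A′ (_ ∷ L) x eq x∈A (here refl) q≢v with LP.∷-injective (trans (sym (chain-step x (spans x) (A⇒≢v x x∈A))) eq)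
    ... | refl , _ = x∈A
    chain⊆A′ (_ ∷ L) x eq x∈A (there q∈) q≢v with LP.∷-injective (trans (sym (chain-step x (spans x) (A⇒≢v x x∈A))) eq)
    ... | refl , eqL with x FP.≟ a
    ... | yes refl = ⊥-elim (q≢v (AnyP.singleton⁻ (subst (_ ∈_) (trans (sym eqL) (trans (cong chain parent-a) chain-root)) q∈)))
    ... | no x≢a = chain⊆A′ L (parent x) eqL (A-parent x x∈A x≢a) q∈ q≢v

    chain⊆A : ∀ x → A x → ∀ {q} → q ∈ chain x → q ≢ v → A q
    chain⊆A x = chain⊆A′ (chain x) x refl

    Crossing : Fin n → Set
    Crossing w = Σ (Edge n) λ e → e ∈ₑ E (colour w) × Σ (Fin n) λ x → Σ (Fin n) λ y → Joins e x y × A x × ¬ A y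

    crossing? : Dec (Σ (Fin n) λ w → A w × w ≢ a × Crossing w)
    crossing? = any? λ w → A? w ×-dec ¬? (w FP.≟ a) ×-dec
                  any-edge? (λ e → member? (colour w) e ×-dec any? (λ x → any? (λ y → Joins? e x y ×-dec A? x ×-dec ¬? (A? y))))

    no-crossing⇒sealed : ¬ (Σ (Fin n) λ w → A w × w ≢ a × Crossing w) → Sealed S
    no-crossing⇒sealed none w w∈A w≢a =
      member-within (colour w) A closed (tree-edge w w≢v) (tree-edge-∈ w w≢v) w (parent w) (tree-edge-joins w w≢v) w∈A
      where
      w≢v : w ≢ v
      w≢v = A⇒≢v w w∈A
      closed : ∀ e → e ∈ₑ E (colour w) → ∀ x y → Joins e x y → A x → A y
      closed e e∈ x y jn x∈A with A? y
      ... | yes y∈A = y∈A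
      ... | no y∉A = ⊥-elim (none (w , w∈A , w≢a , e , e∈ , x , y , jn , x∈A , y∉A))

    colour∉root-route : ∀ w x → w ∉ chain x → w ≢ v → ∀ {c} → c ∈ colours (root-route x) → c ≢ colour w
    colour∉root-route w x w∉ w≢v c∈ eq with root-route-colours x c∈
    ... | q , q∈ , q≢v , refl = w∉ (subst (_∈ chain x) (colour-injective q w (spans q) (spans w) q≢v w≢v eq) q∈)

    -- Down the tree from x to v, out along the outside route to y, and back to x by colour w.
    crossing-off-chain⇒⊥ : ∀ w → A w → w ≢ a → ∀ x y e → e ∈ₑ E (colour w) → Joins e x y → A x → ¬ A y →
                           w ∉ chain x → ⊥
    crossing-off-chain⇒⊥ w w∈A w≢a x y e e∈ jn x∈A y∉A w∉ =
      no-rainbow (route+link⇒rainbow-cycle P P! 3≤|P| P-colours! (Links-via e∈ (Joins-sym {e} jn)))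
      where
      w≢v : w ≢ v
      w≢v = A⇒≢v w w∈A
      x≢v : x ≢ v
      x≢v = A⇒≢v x x∈A
      R : Route x v
      R = root-route x
      O : OutsideRoute A y
      O = outside-route y y∉A
      open OutsideRoute O renaming (path to Q)
      P : Route x y
      P = R ++ᴿ Q
      P! : Unique (vertices P)
      P! = Unique-++ᴿ R Q (root-route-unique x) vertices! meet-at-v
        where
        meet-at-v : ∀ {q} → q ∈ vertices R → q ∈ vertices Q → q ≡ v
        meet-at-v {q} q∈R q∈Q with q FP.≟ v
        ... | yes q≡v = q≡v
        ... | no q≢v = ⊥-elim (All.lookup avoids q∈Q (chain⊆A x x∈A (subst (q ∈_) (root-route-vertices x) q∈R) q≢v))
      x≢a : y ≡ v → x ≢ a
      x≢a refl refl = colour-w≢c₁ (edge-a-v-only-in-c₁ e e∈ jn)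
        where
        colour-w≢c₁ : colour w ≢ c₁
        colour-w≢c₁ eq = w≢a (colour-injective w a (spans w) (spans a) w≢v a≢v (trans eq (sym colour-a)))
      4≤|R|+|Q| : 4 ≤ length (vertices R) + length (vertices Q)
      4≤|R|+|Q| with y FP.≟ v
      ... | no y≢v = ℕP.+-mono-≤ (Unique⇒2≤length x≢v (start∈ R) (end∈ R) (root-route-unique x))
                                 (Unique⇒2≤length (λ v≡y → y≢v (sym v≡y)) (start∈ Q) (end∈ Q) vertices!)
      ... | yes y≡v = ℕP.+-mono-≤ (Unique⇒3≤length (x≢a y≡v) x≢v a≢v (start∈ R)
                                    (subst (a ∈_) (sym (root-route-vertices x)) (A-below-a x x∈A)) (end∈ R) (root-route-unique x))
                                  (∈P.∈-length (start∈ Q))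
      3≤|P| : 3 ≤ length (vertices P)
      3≤|P| = ℕP.≤-pred (subst (4 ≤_) (sym (length-++ᴿ R Q)) 4≤|R|+|Q|)
      P-colours! : Unique (colours P ++ colour w ∷ [])
      P-colours! = UniqueP.++⁺ (UniqueP.++⁺ (root-route-colours-unique x) colours! R#Q) ([] ∷ []) P#w
        where
        R#Q : Disjoint (colours R) (colours Q)
        R#Q (c∈R , c∈Q) with root-route-colours x c∈R
        ... | q , q∈ , q≢v , refl = All.lookup avoids-colours c∈Q q (chain⊆A x x∈A q∈ q≢v) refl
        P#w : Disjoint (colours R ++ colours Q) (colour w ∷ [])
        P#w (c∈ , here refl) with ∈P.∈-++⁻ (colours R) c∈
        ... | inj₁ c∈R = colour∉root-route w x w∉ w≢v c∈R refl
        ... | inj₂ c∈Q = All.lookup avoids-colours c∈Q w w∈A refl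

    -- Vertices of the subtree of w are now reached from v through y, the crossing edge y x of
    -- colour w, and the tree from x.
    module Shrink (w : Fin n) (w∈A : A w) (w≢a : w ≢ a) (x y : Fin n) (e : Edge n) (e∈ : e ∈ₑ E (colour w))
                  (jn : Joins e x y) (x∈A : A x) (y∉A : ¬ A y) (w∈x : w ∈ chain x) where
      w≢v : w ≢ v
      w≢v = A⇒≢v w w∈A

      A′ : Fin n → Set
      A′ z = A z × w ∉ chain z

      A′? : Decidable A′
      A′? z = A? z ×-dec ¬? (w ∈ⱽ? chain z)

      ∉A′-cases : ∀ z → ¬ A′ z → ¬ A z ⊎ (A z × w ∈ chain z)
      ∉A′-cases z z∉A′ with A? z | w ∈ⱽ? chain z
      ... | no z∉A | _ = inj₁ z∉A
      ... | yes z∈A | yes w∈ = inj₂ (z∈A , w∈)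
      ... | yes z∈A | no w∉ = ⊥-elim (z∉A′ (z∈A , w∉))

      below-w⇒NotAColour : ∀ {q c} → q ≢ v → w ∈ chain q → colour q ≡ c → NotAColour A′ c
      below-w⇒NotAColour {q} q≢v w∈q refl z (z∈A , w∉z) eq =
        w∉z (subst (λ t → w ∈ chain t) (sym (colour-injective z q (spans z) (spans q) (A⇒≢v z z∈A) q≢v eq)) w∈q)

      NotAColour-A′ : ∀ {c} → NotAColour A c → NotAColour A′ c
      NotAColour-A′ not-A z (z∈A , _) = not-A z z∈A

      Oy : OutsideRoute A y
      Oy = outside-route y y∉A
      open OutsideRoute Oy renaming (path to Qy)

      Px : Route v x
      Px = Qy ++ᴿ edge-route (Links-via e∈ (Joins-sym {e} jn))

      Px-vertices : ∀ {q} → q ∈ vertices Px → q ≡ x ⊎ ¬ A q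
      Px-vertices q∈ with ∈-++ᴿ⁻ Qy (edge-route (Links-via e∈ (Joins-sym {e} jn))) q∈
      ... | inj₁ q∈Q = inj₂ (All.lookup avoids q∈Q)
      ... | inj₂ (here refl) = inj₂ y∉A
      ... | inj₂ (there (here refl)) = inj₁ refl

      Px-unique : Unique (vertices Px)
      Px-unique = Unique-++ᴿ Qy (edge-route (Links-via e∈ (Joins-sym {e} jn))) vertices!
                    (((λ y≡x → y∉A (subst A (sym y≡x) x∈A)) ∷ []) ∷ [] ∷ []) meet-at-y
        where
        meet-at-y : ∀ {q} → q ∈ vertices Qy → q ∈ y ∷ x ∷ [] → q ≡ y
        meet-at-y _ (here refl) = refl
        meet-at-y q∈Q (there (here refl)) = ⊥-elim (All.lookup avoids q∈Q x∈A)

      Px-colours : ∀ {c} → c ∈ colours Px → c ≡ colour w ⊎ NotAColour A c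
      Px-colours c∈ with ∈P.∈-++⁻ (colours Qy) c∈
      ... | inj₁ c∈Q = inj₂ (All.lookup avoids-colours c∈Q)
      ... | inj₂ (here refl) = inj₁ refl

      Px-colours-unique : Unique (colours Px)
      Px-colours-unique = UniqueP.++⁺ colours! ([] ∷ []) λ { (c∈ , here refl) → All.lookup avoids-colours c∈ w w∈A refl }

      module IntoSubtree (y′ : Fin n) (y′∈A : A y′) (w∈y′ : w ∈ chain y′) where
        open Meet (meet x y′ (spans x) (spans y′))
          renaming (py to qx; px to qy; u to u₀; iu to iu₀; ey to ex; ex to ey′; dj to qx#y′)
        Tp : Route x y′
        Tp = tree-route x y′ (spans x) (spans y′)

        w∈u₀ : w ∈ chain u₀
        w∈u₀ with ∈P.∈-++⁻ qx (subst (w ∈_) ex w∈x)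
        ... | inj₁ w∈qx = ⊥-elim (qx#y′ (w∈qx , w∈y′))
        ... | inj₂ w∈u₀ = w∈u₀

        w∉qy : w ∉ qy
        w∉qy w∈qy = proj₂ (proj₂ (Unique-++⁻ qy (subst Unique ey′ (chain-unique y′ (spans y′))))) (w∈qy , w∈u₀)

        u₀≢v : u₀ ≢ v
        u₀≢v u₀≡v = w≢v (AnyP.singleton⁻ (subst (w ∈_) (trans (cong chain u₀≡v) chain-root) w∈u₀))

        side : ∀ {q} → q ∈ qx ⊎ q ∈ qy → A q × w ∈ chain q × q ≢ v × q ≢ w
        side (inj₁ q∈) = chain⊆A x x∈A (subst (_ ∈_) (sym ex) (∈P.∈-++⁺ˡ q∈)) (prefix≢root qx x (spans x) iu₀ ex q∈)
                       , prefix-chain⊇ qx x u₀ (spans x) ex q∈ w∈u₀ , prefix≢root qx x (spans x) iu₀ ex q∈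
                       , λ { refl → qx#y′ (q∈ , w∈y′) }
        side (inj₂ q∈) = chain⊆A y′ y′∈A (subst (_ ∈_) (sym ey′) (∈P.∈-++⁺ˡ q∈)) (prefix≢root qy y′ (spans y′) iu₀ ey′ q∈)
                       , prefix-chain⊇ qy y′ u₀ (spans y′) ey′ q∈ w∈u₀ , prefix≢root qy y′ (spans y′) iu₀ ey′ q∈
                       , λ { refl → w∉qy q∈ }

        Tp-vertices : ∀ {q} → q ∈ vertices Tp → A q × w ∈ chain q
        Tp-vertices q∈ with tree-route-∈ x y′ (spans x) (spans y′) q∈
        ... | inj₁ q∈qx = proj₁ (side (inj₁ q∈qx)) , proj₁ (proj₂ (side (inj₁ q∈qx)))
        ... | inj₂ (inj₂ q∈qy) = proj₁ (side (inj₂ q∈qy)) , proj₁ (proj₂ (side (inj₂ q∈qy)))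
        ... | inj₂ (inj₁ refl) =
          chain⊆A x x∈A (subst (u₀ ∈_) (sym ex) (∈P.∈-++⁺ʳ qx {ys = chain u₀} (∈chain-self u₀ iu₀))) u₀≢v , w∈u₀

        Tp-colours : ∀ {c} → c ∈ colours Tp → ∃ λ q → (q ∈ qx ⊎ q ∈ qy) × colour q ≡ c
        Tp-colours c∈ with ∈P.∈-++⁻ (map colour qx) c∈
        ... | inj₁ c∈qx with ∈P.∈-map⁻ colour c∈qx
        ...   | q , q∈ , refl = q , inj₁ q∈ , refl
        Tp-colours c∈ | inj₂ c∈qy with ∈P.∈-map⁻ colour (AnyP.reverse⁻ {xs = map colour qy} c∈qy)
        ...   | q , q∈ , refl = q , inj₂ q∈ , refl

        P′ : Route v y′
        P′ = Px ++ᴿ Tp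

        P′-avoids : ∀ {q} → q ∈ vertices P′ → ¬ A′ q
        P′-avoids q∈ with ∈-++ᴿ⁻ Px Tp q∈
        ... | inj₂ q∈Tp = λ (_ , w∉q) → w∉q (proj₂ (Tp-vertices q∈Tp))
        ... | inj₁ q∈Px with Px-vertices q∈Px
        ...   | inj₁ refl = λ (_ , w∉x) → w∉x w∈x
        ...   | inj₂ q∉A = λ (q∈A , _) → q∉A q∈A

        P′-avoids-colours : ∀ {c} → c ∈ colours P′ → NotAColour A′ c
        P′-avoids-colours c∈ with ∈P.∈-++⁻ (colours Px) c∈
        ... | inj₁ c∈Px with Px-colours c∈Px
        ...   | inj₁ refl = below-w⇒NotAColour w≢v (∈chain-self w (spans w)) refl
        ...   | inj₂ not-A = NotAColour-A′ not-A
        P′-avoids-colours c∈ | inj₂ c∈Tp with Tp-colours c∈Tp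
        ...   | q , q-side , refl = below-w⇒NotAColour (proj₁ (proj₂ (proj₂ (side q-side)))) (proj₁ (proj₂ (side q-side))) refl

        outside-route′ : OutsideRoute A′ y′
        outside-route′ = record
          { path = P′ ; vertices! = P′-unique ; colours! = P′-colours-unique
          ; avoids = All.tabulate P′-avoids ; avoids-colours = All.tabulate P′-avoids-colours }
          where
          P′-unique : Unique (vertices P′)
          P′-unique = Unique-++ᴿ Px Tp Px-unique (tree-route-unique x y′ (spans x) (spans y′)) meet-at-x
            where
            meet-at-x : ∀ {q} → q ∈ vertices Px → q ∈ vertices Tp → q ≡ x
            meet-at-x q∈Px q∈Tp with Px-vertices q∈Px
            ... | inj₁ q≡x = q≡x
            ... | inj₂ q∉A = ⊥-elim (q∉A (proj₁ (Tp-vertices q∈Tp)))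
          P′-colours-unique : Unique (colours P′)
          P′-colours-unique = UniqueP.++⁺ Px-colours-unique (tree-route-colours-unique x y′ (spans x) (spans y′)) Px#Tp
            where
            Px#Tp : Disjoint (colours Px) (colours Tp)
            Px#Tp (c∈Px , c∈Tp) with Tp-colours c∈Tp
            ... | q , q-side , refl with Px-colours c∈Px | side q-side
            ... | inj₁ eq | _ , _ , q≢v , q≢w = q≢w (colour-injective q w (spans q) (spans w) q≢v w≢v eq)
            ... | inj₂ not-A | q∈A , _ = not-A q q∈A refl

      shrunk : Pocket
      shrunk = record
        { A = A′ ; A? = A′? ; a∈A = a∈A , w∉a ; A-below-a = λ z (z∈A , _) → A-below-a z z∈A
        ; A-parent = A′-parent ; outside-route = outside-route′ }
        where
        w∉a : w ∉ chain a
        w∉a w∈a with subst (w ∈_) chain-a w∈a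
        ... | here w≡a = w≢a w≡a
        ... | there (here w≡v) = w≢v w≡v
        A′-parent : ∀ z → A′ z → z ≢ a → A′ (parent z)
        A′-parent z (z∈A , w∉z) z≢a =
          A-parent z z∈A z≢a , λ w∈ → w∉z (subst (w ∈_) (sym (chain-step z (spans z) (A⇒≢v z z∈A))) (there w∈))
        outside-route′ : ∀ y′ → ¬ A′ y′ → OutsideRoute A′ y′
        outside-route′ y′ y′∉A′ with ∉A′-cases y′ y′∉A′
        ... | inj₂ (y′∈A , w∈y′) = IntoSubtree.outside-route′ y′ y′∈A w∈y′
        ... | inj₁ y′∉A = record
          { path = OutsideRoute.path O ; vertices! = OutsideRoute.vertices! O ; colours! = OutsideRoute.colours! O
          ; avoids = All.map (λ q∉A (q∈A , _) → q∉A q∈A) (OutsideRoute.avoids O)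
          ; avoids-colours = All.map NotAColour-A′ (OutsideRoute.avoids-colours O) }
          where
          O : OutsideRoute A y′
          O = outside-route y′ y′∉A

      shrinks : size shrunk < size S
      shrinks = Unique⇒length< (UniqueP.filter⁺ A′? (UniqueP.allFin⁺ n)) A′⊆A
                  (∈P.∈-filter⁺ A? (∈P.∈-allFin w) w∈A)
                  (λ w∈A′ → proj₂ (proj₂ (∈P.∈-filter⁻ A′? {xs = allFin n} w∈A′)) (∈chain-self w (spans w)))
        where
        A′⊆A : filter A′? (allFin n) ⊆ filter A? (allFin n)
        A′⊆A z∈ with ∈P.∈-filter⁻ A′? {xs = allFin n} z∈
        ... | z∈all , z∈A , _ = ∈P.∈-filter⁺ A? z∈all z∈A

  seal : ∀ fuel (S : Pocket) → size S ≤ fuel → Σ Pocket Sealed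
  seal fuel S bound with PocketLemmas.crossing? S
  ... | no none = S , PocketLemmas.no-crossing⇒sealed S none
  ... | yes (w , w∈A , w≢a , e , e∈ , x , y , jn , x∈A , y∉A) with w ∈ⱽ? chain x
  ... | no w∉x = ⊥-elim (PocketLemmas.crossing-off-chain⇒⊥ S w w∈A w≢a x y e e∈ jn x∈A y∉A w∉x)
  seal zero S bound | yes (w , w∈A , w≢a , e , e∈ , x , y , jn , x∈A , y∉A) | yes w∈x =
    ⊥-elim (ℕP.n≮0 (ℕP.<-≤-trans (PocketLemmas.Shrink.shrinks S w w∈A w≢a x y e e∈ jn x∈A y∉A w∈x) bound))
  seal (suc fuel) S bound | yes (w , w∈A , w≢a , e , e∈ , x , y , jn , x∈A , y∉A) | yes w∈x =
    seal fuel Sh.shrunk (ℕP.≤-pred (ℕP.≤-trans Sh.shrinks bound))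
    where module Sh = PocketLemmas.Shrink S w w∈A w≢a x y e e∈ jn x∈A y∉A w∈x

  initial-pocket : Pocket
  initial-pocket = record
    { A = λ z → a ∈ chain z ; A? = λ z → a ∈ⱽ? chain z ; a∈A = ∈chain-self a (spans a)
    ; A-below-a = λ _ a∈ → a∈ ; A-parent = below-a-parent ; outside-route = tree-route-from-v }
    where
    below-a⇒≢v : ∀ z → a ∈ chain z → z ≢ v
    below-a⇒≢v z a∈ refl = a≢v (AnyP.singleton⁻ (subst (a ∈_) chain-root a∈))
    below-a-parent : ∀ z → a ∈ chain z → z ≢ a → a ∈ chain (parent z)
    below-a-parent z a∈ z≢a with subst (a ∈_) (chain-step z (spans z) (below-a⇒≢v z a∈)) a∈
    ... | here a≡z = ⊥-elim (z≢a (sym a≡z))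
    ... | there a∈′ = a∈′
    tree-route-from-v : ∀ y → a ∉ chain y → OutsideRoute (λ z → a ∈ chain z) y
    tree-route-from-v y a∉y = record
      { path = reverseᴿ (root-route y) ; vertices! = Unique-reverse (root-route-unique y)
      ; colours! = Unique-reverse (root-route-colours-unique y)
      ; avoids = All.tabulate avoids′ ; avoids-colours = All.tabulate avoids-colours′ }
      where
      above-y : ∀ {q} → q ∈ chain y → a ∉ chain q
      above-y q∈ a∈q with chain-split y (spans y) q∈
      ... | pre , eq = a∉y (subst (a ∈_) (sym eq) (∈P.∈-++⁺ʳ pre a∈q))
      avoids′ : ∀ {q} → q ∈ vertices (reverseᴿ (root-route y)) → a ∉ chain q
      avoids′ {q} q∈ = above-y (subst (q ∈_) (root-route-vertices y) (AnyP.reverse⁻ q∈))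
      avoids-colours′ : ∀ {c} → c ∈ colours (reverseᴿ (root-route y)) → NotAColour (λ z → a ∈ chain z) c
      avoids-colours′ c∈ z a∈z eq with root-route-colours y (AnyP.reverse⁻ c∈)
      ... | q , q∈ , q≢v , refl =
        above-y q∈ (subst (λ t → a ∈ chain t) (colour-injective z q (spans z) (spans q) (below-a⇒≢v z a∈z) q≢v eq) a∈z)

  sealed-pocket : Σ Pocket Sealed
  sealed-pocket = seal (size initial-pocket) initial-pocket ℕP.≤-refl

  module Conclusion (S : Pocket) (sealed : Sealed S) where
    open Pocket S
    open PocketLemmas S

    B : Fin n → Set
    B z = A z × z ≢ a

    B? : Decidable B
    B? z = A? z ×-dec ¬? (z FP.≟ a)

    Bs : List (Fin n)
    Bs = filter B? (allFin n)

    ℓ : ℕ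
    ℓ = length Bs

    cycles : Fin ℓ → Fin k
    cycles i = colour (lookup Bs i)

    Bs! : Unique Bs
    Bs! = UniqueP.filter⁺ B? (UniqueP.allFin⁺ n)

    ∈Bs⁻ : ∀ {z} → z ∈ Bs → B z
    ∈Bs⁻ z∈ = proj₂ (∈P.∈-filter⁻ B? {xs = allFin n} z∈)

    A⊆v∷a∷Bs : ∀ {z} → A z → z ∈ v ∷ a ∷ Bs
    A⊆v∷a∷Bs {z} z∈A with z FP.≟ a
    ... | yes z≡a = there (here z≡a)
    ... | no z≢a = there (there (∈P.∈-filter⁺ B? (∈P.∈-allFin z) (z∈A , z≢a)))

    lookup-B : ∀ i → B (lookup Bs i)
    lookup-B i = ∈Bs⁻ (∈P.∈-lookup i)

    cycles-injective : ∀ i j → cycles i ≡ cycles j → i ≡ j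
    cycles-injective i j eq = Unique-lookup-injective Bs! i j
      (colour-injective _ _ (spans _) (spans _) (A⇒≢v _ (proj₁ (lookup-B i))) (A⇒≢v _ (proj₁ (lookup-B j))) eq)

    -- A star coloured by z would contain z's tree edge, forcing parent z = v into A.
    cycles-are-cycles : ∀ i → IsCycle (E (cycles i))
    cycles-are-cycles i with star-or-cycle (cycles i)
    ... | inj₂ cycle = cycle
    ... | inj₁ star = ⊥-elim (v∉A (subst A (star-colour⇒parent≡v z (A⇒≢v z z∈A) star) (A-parent z z∈A z≢a)))
      where
      z : Fin n
      z = lookup Bs i
      z∈A : A z
      z∈A = proj₁ (lookup-B i)
      z≢a : z ≢ a
      z≢a = proj₂ (lookup-B i)

    cycles-avoid-v : ∀ i e → e ∈ₑ E (cycles i) → ¬ Incident v e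
    cycles-avoid-v i e e∈ v∈e with Incident⇒Joins {e} v∈e
    ... | q , jv = v∉A (sealed _ (proj₁ (lookup-B i)) (proj₂ (lookup-B i)) e e∈ v q jv)

    -- The outside route to a neighbour b of v closes, by the star's edge b v, into a rainbow
    -- cycle, unless it is a single edge, which the star cannot share.
    module OutsideNeighbour {b} (O : OutsideRoute A b) (e : Edge n) (e∈ : e ∈ₑ E c₁) (jn : Joins e v b) where
      open OutsideRoute O renaming (path to Q)

      c₁∉Q : ∀ {c} → c ∈ colours Q → c ≢ c₁
      c₁∉Q c∈ c≡c₁ = All.lookup avoids-colours c∈ a a∈A (trans colour-a (sym c≡c₁))

      impossible : ⊥
      impossible with 3 ℕP.≤? length (vertices Q)
      ... | yes 3≤|Q| = no-rainbow (route+link⇒rainbow-cycle Q vertices! 3≤|Q|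
                          (UniqueP.++⁺ colours! ([] ∷ []) λ { (c∈ , here refl) → c₁∉Q c∈ refl }) (Links-via e∈ (Joins-sym {e} jn)))
      ... | no 3≰|Q| with two-vertex-route Q (ℕP.≤-antisym (ℕP.≤-pred (ℕP.≰⇒> 3≰|Q|))
                                                (Unique⇒2≤length (Joins⇒≢ {e} jn) (start∈ Q) (end∈ Q) vertices!))
      ... | c , c∈ , vb = star-edge-unshared c₁ star₁ c (c₁∉Q c∈) e e∈ (vb e jn)

    star₁-inside : ∀ e → e ∈ₑ E c₁ → ∀ b → Joins e v b → A b
    star₁-inside e e∈ b jn with A? b
    ... | yes b∈A = b∈A
    ... | no b∉A = ⊥-elim (OutsideNeighbour.impossible (outside-route b b∉A) e e∈ jn)

    0<ℓ : 0 < ℓ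
    0<ℓ = two-neighbours star₁
      where
      two-neighbours : IsStarAt v (E c₁) → 0 < ℓ
      two-neighbours (at-v , e₁ , e₂ , e₁≢e₂ , e₁∈ , e₂∈)
        with Incident⇒Joins {e₁} (at-v e₁ e₁∈) | Incident⇒Joins {e₂} (at-v e₂ e₂∈)
      ... | b₁ , j₁ | b₂ , j₂ with b₁ FP.≟ a | b₂ FP.≟ a
      ... | no b₁≢a | _ = ∈P.∈-length (∈P.∈-filter⁺ B? (∈P.∈-allFin b₁) (star₁-inside e₁ e₁∈ b₁ j₁ , b₁≢a))
      ... | yes _ | no b₂≢a = ∈P.∈-length (∈P.∈-filter⁺ B? (∈P.∈-allFin b₂) (star₁-inside e₂ e₂∈ b₂ j₂ , b₂≢a))
      ... | yes refl | yes refl = ⊥-elim (e₁≢e₂ (Joins-unique {e₁} {e₂} j₁ j₂))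

    ℓ+2≤n : ℓ + 2 ≤ n
    ℓ+2≤n = subst₂ _≤_ (ℕP.+-comm 2 ℓ) (LP.length-tabulate id)
              (Unique⇒length≤ (All.tabulate v∉ ∷ All.tabulate a∉Bs ∷ Bs!) (λ _ → ∈P.∈-allFin _))
      where
      v∉ : ∀ {z} → z ∈ a ∷ Bs → v ≢ z
      v∉ (here refl) v≡a = a≢v (sym v≡a)
      v∉ (there z∈) refl = v∉A (proj₁ (∈Bs⁻ z∈))
      a∉Bs : ∀ {z} → z ∈ Bs → a ≢ z
      a∉Bs z∈ a≡z = proj₂ (∈Bs⁻ z∈) (sym a≡z)

    Union : Edge n → Set
    Union e = (e ∈ₑ E c₁) ⊎ (∃[ i ] (e ∈ₑ E (cycles i)))

    covered-in : ∀ x → Covers Union x → x ∈ v ∷ a ∷ Bs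
    covered-in x (e , inj₁ e∈ , x∈e) with Incident⇒Joins {e} (proj₁ star₁ e e∈) | Incident⇒Joins {e} x∈e
    ... | b , jb | q , jq with Joins-ends {e = e} jq jb
    ... | inj₁ (x≡v , _) = here x≡v
    ... | inj₂ (x≡b , _) = A⊆v∷a∷Bs (subst A (sym x≡b) (star₁-inside e e∈ b jb))
    covered-in x (e , inj₂ (i , e∈) , x∈e) with Incident⇒Joins {e} x∈e
    ... | q , jq = A⊆v∷a∷Bs (sealed _ (proj₁ (lookup-B i)) (proj₂ (lookup-B i)) e e∈ x q jq)

    few-vertices : AtMostVertices (ℓ + 2) Union
    few-vertices = subst (λ t → AtMostVertices t Union) (ℕP.+-comm 2 ℓ) (covered-in⇒AtMostVertices v (a ∷ Bs) covered-in)

proposition3p5 : (m : ℕ) (v : Fin (suc (suc m))) (ℰ : Fin (suc m) → EdgeSet (suc (suc m))) →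
    (∀ i → IsStarAt v (ℰ i) ⊎ IsCycle (ℰ i)) →
    ¬ HasRainbowCycle ℰ →
    (∀ i → IsStarAt v (ℰ i) → ∀ j → j ≢ i → ∀ e → e ∈ₑ ℰ i → ℰ j e ≡ false) →
    IsStarAt v (ℰ zero) →
    ∃[ ℓ ] Σ (Fin ℓ → Fin (suc m)) λ c →
      (0 < ℓ) × (ℓ < suc m) ×
      (∀ a b → c a ≡ c b → a ≡ b) ×
      (∀ a → IsCycle (ℰ (c a))) ×
      (∀ a e → e ∈ₑ ℰ (c a) → ¬ Incident v e) ×
      AtMostVertices (ℓ + 2) (λ e → (e ∈ₑ ℰ zero) ⊎ (∃[ a ] (e ∈ₑ ℰ (c a))))
proposition3p5 m v ℰ star-or-cycle no-rainbow star-disjoint star₀ =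
  ℓ , cycles , 0<ℓ , ℓ<1+m , cycles-injective , cycles-are-cycles , cycles-avoid-v , few-vertices
  where
  spanning : Σ (Fin (suc (suc m)) → Set) λ In → Trees.RainbowTree ℰ v In × (∀ z → In z)
  spanning = Family.rainbow-spanning-tree ℰ v star-or-cycle no-rainbow star-disjoint v zero ℕP.≤-refl
  open StarComponent ℰ v star-or-cycle no-rainbow star-disjoint zero star₀ (proj₁ (proj₂ spanning)) (proj₂ (proj₂ spanning))
  open Conclusion (proj₁ sealed-pocket) (proj₂ sealed-pocket)
  ℓ<1+m : ℓ < suc m
  ℓ<1+m = ℕP.≤-pred (subst (_≤ suc (suc m)) (ℕP.+-comm ℓ 2) ℓ+2≤n)
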